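{- Let $n$ be even and $f=\gamma_0+\sum_{i=1}^{n-1}a_i\gamma_{2i}$ with $a_i\in\mathbb{F}_2$. Then $f$ is a permutation of $\mathbb{F}_2^n$ if and only if $\big[1+\sum_{i=1}^{n-1}a_iX^i\big]$ is a unit in $\mathbb{F}_2[X]/(X^n+X^{n/2})$, equivalently if and only if, in $\mathbb{F}_2[X]$, $$\gcd\Big(1+\sum_{i=1}^{n-1}a_iX^i,\;1+X^{n/2}\Big)=\gcd\Big(1+\sum_{i=1}^{n-1}a_iX^i,\;1+X^m\Big)=1,$$ where $m$ is the largest odd divisor of $n$.
   Context: Let $\mathbbm{1}=(1,\dots,1)\in\mathbb{F}_2^n$, let $\odot$ denote component-wise multiplication in $\mathbb{F}_2^n$, and let $S(x_1,\dots,x_n)=(x_2,\dots,x_n,x_1)$. Define $\gamma_0=\mathrm{id}$ and, for $k\geq1$, $\gamma_{2k}(x)=S^{2k}(x)\odot(\mathbbm{1}+S^{2k-1}(x))\odot(\mathbbm{1}+S^{2k-3}(x))\odot\cdots\odot(\mathbbm{1}+S(x))$, as functions $\mathbb{F}_2^n\to\mathbb{F}_2^n$; sums of functions are pointwise. -}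

module Defs where

open import Data.Bool using (Bool; true; false; not; _∧_; _xor_; if_then_else_)
open import Data.Nat using (ℕ; zero; suc; _+_; _*_; _∸_; _≤_)
open import Data.Nat.Divisibility using (_∣_)
open import Data.Vec using (Vec; []; _∷_; _∷ʳ_; zipWith; replicate; map)
open import Data.List as L using (List; []; _∷_)
open import Data.Product using (Σ; ∃; _×_; _,_)
open import Relation.Binary.PropositionalEquality using (_≡_)
open import Relation.Nullary using (¬_)
open import Function using (id)

-- F₂ⁿ as Vec Bool n  (true = 1, false = 0)

_⊕_ : ∀ {n} → Vec Bool n → Vec Bool n → Vec Bool n
_⊕_ = zipWith _xor_

_⊙_ : ∀ {n} → Vec Bool n → Vec Bool n → Vec Bool n
_⊙_ = zipWith _∧_

𝟙 : ∀ {n} → Vec Bool n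
𝟙 {n} = replicate n true

𝟘 : ∀ {n} → Vec Bool n
𝟘 {n} = replicate n false

S : ∀ {n} → Vec Bool n → Vec Bool n
S []       = []
S (x ∷ xs) = xs ∷ʳ x

S^ : ∀ {n} → ℕ → Vec Bool n → Vec Bool n
S^ zero    x = x
S^ (suc j) x = S (S^ j x)

oddProd : ∀ {n} → ℕ → Vec Bool n → Vec Bool n
oddProd zero    x = 𝟙
oddProd (suc j) x = (𝟙 ⊕ S^ (suc (2 * j)) x) ⊙ oddProd j x

-- γ k = γ_{2k} of the paper; γ 0 = id
γ : ∀ {n} → ℕ → Vec Bool n → Vec Bool n
γ zero    x = x
γ (suc k) x = S^ (2 * suc k) x ⊙ oddProd (suc k) x

γsum : ∀ {n} → (ℕ → Bool) → ℕ → Vec Bool n → Vec Bool n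
γsum a zero    x = 𝟘
γsum a (suc j) x = γsum a j x ⊕ (if a (suc j) then γ (suc j) x else 𝟘)

fMap : (n : ℕ) → (ℕ → Bool) → Vec Bool n → Vec Bool n
fMap n a x = γ 0 x ⊕ γsum a (n ∸ 1) x

-- F₂[X]: coefficient lists, lowest degree first (trailing zeros allowed)

Poly : Set
Poly = List Bool

coeff : Poly → ℕ → Bool
coeff []       i       = false
coeff (c ∷ p)  zero    = c
coeff (c ∷ p)  (suc i) = coeff p i

_≈ₚ_ : Poly → Poly → Set
p ≈ₚ q = ∀ i → coeff p i ≡ coeff q i

_+ₚ_ : Poly → Poly → Poly
[]      +ₚ q       = q
(c ∷ p) +ₚ []      = c ∷ p
(c ∷ p) +ₚ (d ∷ q) = (c xor d) ∷ (p +ₚ q)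

_*ₚ_ : Poly → Poly → Poly
[]      *ₚ q = []
(c ∷ p) *ₚ q = (if c then q else []) +ₚ (false ∷ (p *ₚ q))

oneₚ : Poly
oneₚ = true ∷ []

X^ : ℕ → Poly
X^ i = L.replicate i false L.++ (true ∷ [])

_∣ₚ_ : Poly → Poly → Set
d ∣ₚ p = Σ Poly λ e → (d *ₚ e) ≈ₚ p

GcdOne : Poly → Poly → Set
GcdOne p q = ∀ d → d ∣ₚ p → d ∣ₚ q → d ∣ₚ oneₚ

IsUnitMod : Poly → Poly → Set
IsUnitMod M p = Σ Poly λ g → Σ Poly λ h → (p *ₚ g) ≈ₚ (oneₚ +ₚ (h *ₚ M))

aPoly : ℕ → (ℕ → Bool) → Poly
aPoly n a = true ∷ L.applyUpTo (λ i → a (suc i)) (n ∸ 1)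

Odd : ℕ → Set
Odd d = ¬ (2 ∣ d)

IsLargestOddDivisor : ℕ → ℕ → Set
IsLargestOddDivisor m n = (m ∣ n) × Odd m × (∀ d → d ∣ n → Odd d → d ≤ m)

module Submission where

-- Read x ∈ F₂ⁿ as an n-periodic sequence X, so that
--   f(X)ₚ = Xₚ + Σₖ aₖ X_{p+2k} (1 + X_{p+1})(1 + X_{p+3})⋯(1 + X_{p+2k−1});
-- the k-th summand is switched off by any 1 at an odd offset below 2k.
-- If X vanishes on one parity class, f acts on the other one, a sequence of period h = n/2, as
-- the polynomial A = 1 + Σ aᵢXⁱ, and this is injective iff gcd(A, 1 + Xʰ) = 1: a Bézout identity
-- inverts A, while a non-unit common factor d, with 1 + Xʰ = d e, makes r ↦ Σᵢ eᵢ δ_{r+i}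
-- (δ the indicator of hℕ) a nonzero kernel element.
-- If X has 1s of both parities, a 1 followed by an odd gap of 0s is fixed by f, these anchors of
-- X and of f(X) coincide, and X is recovered from f(X) backwards from any anchor.
-- Since A ≡ 1 mod X, gcd(A, 1 + Xʰ) = 1 iff A is a unit modulo Xⁿ + Xʰ = Xʰ(1 + Xʰ); it also
-- gives gcd(A, 1 + Xᵐ) = 1, as 1 + Xᵐ ∣ 1 + Xʰ.

open import Defs

open import Level using (0ℓ; _⊔_)
open import Algebra.Bundles using (CommutativeRing)
open import Data.Bool using (Bool; true; false; not; _∧_; _xor_; if_then_else_)
import Data.Bool.Properties as Boolₚ
open import Data.Bool.Properties
  using (xor-assoc; xor-comm; xor-identityʳ; xor-same; not-injective;
         ∧-identityʳ; ∧-zeroʳ; ∧-distribˡ-xor; ∧-distribʳ-xor; xor-∧-commutativeRing)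
open import Data.Fin as Fin using (Fin; toℕ; fromℕ<; punchOut)
import Data.Fin.Properties as Finₚ
open import Data.Fin.Properties
  using (fromℕ<-cong; fromℕ<-toℕ; toℕ-fromℕ<; toℕ<n; any?; injective⇒≤; punchOut-injective; 2↔Bool; *↔×)
open import Data.List using ([]; _∷_; length; applyUpTo)
import Data.Nat.Coprimality as ℕC
import Data.Nat.Divisibility as ℕ∣
open import Data.Nat.DivMod
  using (_mod_; m*n/n≡m; m%n<n; m≡m%n+[m/n]*n; [m+n]%n≡m%n; m<n⇒m%n≡m; %-distribˡ-+; m%n%n≡m%n; n%n≡0)
import Data.Nat.Properties as ℕ
open import Data.Nat.Tactic.RingSolver using (solve-∀)
open import Data.Parity.Base using (Parity; 0ℙ; 1ℙ; _⁻¹) renaming (_+_ to _+ℙ_; _*_ to _ℙ*_)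
import Data.Parity.Properties as ℙ
open import Data.Product using (_,_; _×_; ∃; proj₁)
open import Data.Product.Function.NonDependent.Propositional using (_×-↔_)
open import Data.Sum using (_⊎_; inj₁; inj₂; [_,_]′)
open import Data.Vec using (Vec; []; _∷_; _∷ʳ_; lookup; tabulate; zipWith; replicate)
open import Data.Vec.Properties
  using (tabulate∘lookup; lookup∘tabulate; tabulate-cong; lookup-zipWith; lookup-replicate)
open import Function using (_∘_; id)
open import Function.Bundles using (Equivalence; _⇔_; mk⇔; Inverse; _↔_; mk↔ₛ′)
open import Function.Definitions using (Injective; Surjective; Bijective)
open import Function.Properties.Equivalence using () renaming (trans to ⇔-trans; sym to ⇔-sym)
open import Function.Properties.Inverse using (↔-trans; ↔-sym)
open import Relation.Binary.Bundles using (Setoid)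
open import Relation.Binary.Definitions using (tri<; tri≈; tri>)
import Relation.Binary.Reasoning.Setoid as SetoidReasoning
open import Relation.Binary.PropositionalEquality
  using (_≡_; _≢_; refl; sym; trans; cong; cong₂; subst; _≗_; module ≡-Reasoning)
open import Relation.Binary.Structures using (IsEquivalence)
open import Relation.Nullary using (¬_; Dec; yes; no; does; _×-dec_; contradiction)
open import Relation.Nullary.Decidable using (dec-true; dec-false; does-⇔)

open import Algebra.Properties.CommutativeSemigroup
    (CommutativeRing.+-commutativeSemigroup xor-∧-commutativeRing)
  using () renaming (interchange to xor-interchange)

-- Coprimality witnessed by a Bézout identity

module BezoutCoprimality {c ℓ} (R : CommutativeRing c ℓ) where
  open CommutativeRing R
  open import Algebra.Properties.CommutativeSemigroup *-commutativeSemigroup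
    using (interchange; x∙yz≈y∙xz; xy∙z≈xz∙y)
  open import Algebra.Properties.CommutativeSemigroup.Divisibility *-commutativeSemigroup
    using (_∣_; _,_; ∣-respʳ)
  open SetoidReasoning setoid

  record Coprime (a b : Carrier) : Set (c ⊔ ℓ) where
    constructor bezout
    field
      s t      : Carrier
      identity : a * s + b * t ≈ 1#

  ∣-linear : ∀ {d a b} s t → d ∣ a → d ∣ b → d ∣ a * s + b * t
  ∣-linear {d} {a} {b} s t (p , pd≈a) (q , qd≈b) = p * s + q * t , (begin
    (p * s + q * t) * d        ≈⟨ distribʳ d (p * s) (q * t) ⟩
    p * s * d + q * t * d      ≈⟨ +-cong (xy∙z≈xz∙y p s d) (xy∙z≈xz∙y q t d) ⟩
    p * d * s + q * d * t      ≈⟨ +-cong (*-congʳ pd≈a) (*-congʳ qd≈b) ⟩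
    a * s + b * t              ∎)

  coprime⇒∣1 : ∀ {a b d} → Coprime a b → d ∣ a → d ∣ b → d ∣ 1#
  coprime⇒∣1 (bezout s t identity) d∣a d∣b = ∣-respʳ identity (∣-linear s t d∣a d∣b)

  coprime-∣ʳ : ∀ {a b d} → Coprime a b → d ∣ b → Coprime a d
  coprime-∣ʳ {a} {b} {d} (bezout s t identity) (q , qd≈b) = bezout s (q * t) (begin
    a * s + d * (q * t)    ≈⟨ +-congˡ (x∙yz≈y∙xz d q t) ⟩
    a * s + q * (d * t)    ≈⟨ +-congˡ (*-assoc q d t) ⟨
    a * s + q * d * t      ≈⟨ +-congˡ (*-congʳ qd≈b) ⟩
    a * s + b * t          ≈⟨ identity ⟩
    1#                     ∎)

  -- Substitute 1 = a s₂ + c t₂ into b t₁ = b t₁ · 1.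
  coprime-*ʳ : ∀ {a b c} → Coprime a b → Coprime a c → Coprime a (b * c)
  coprime-*ʳ {a} {b} {c} (bezout s₁ t₁ identity₁) (bezout s₂ t₂ identity₂) =
    bezout (s₁ + b * (t₁ * s₂)) (t₁ * t₂) (begin
      a * (s₁ + b * (t₁ * s₂)) + b * c * (t₁ * t₂)
        ≈⟨ +-congʳ (distribˡ a s₁ (b * (t₁ * s₂))) ⟩
      a * s₁ + a * (b * (t₁ * s₂)) + b * c * (t₁ * t₂)
        ≈⟨ +-assoc (a * s₁) _ _ ⟩
      a * s₁ + (a * (b * (t₁ * s₂)) + b * c * (t₁ * t₂))
        ≈⟨ +-congˡ (+-cong a[b[ts]]≈bt[as] (interchange b c t₁ t₂)) ⟩
      a * s₁ + (b * t₁ * (a * s₂) + b * t₁ * (c * t₂))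
        ≈⟨ +-congˡ (distribˡ (b * t₁) (a * s₂) (c * t₂)) ⟨
      a * s₁ + b * t₁ * (a * s₂ + c * t₂)
        ≈⟨ +-congˡ (*-congˡ identity₂) ⟩
      a * s₁ + b * t₁ * 1#
        ≈⟨ +-congˡ (*-identityʳ (b * t₁)) ⟩
      a * s₁ + b * t₁
        ≈⟨ identity₁ ⟩
      1# ∎)
    where
    a[b[ts]]≈bt[as] : a * (b * (t₁ * s₂)) ≈ b * t₁ * (a * s₂)
    a[b[ts]]≈bt[as] = begin
      a * (b * (t₁ * s₂))   ≈⟨ x∙yz≈y∙xz a b _ ⟩
      b * (a * (t₁ * s₂))   ≈⟨ *-congˡ (x∙yz≈y∙xz a t₁ s₂) ⟩
      b * (t₁ * (a * s₂))   ≈⟨ *-assoc b t₁ _ ⟨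
      b * t₁ * (a * s₂)     ∎

-- Opened only here, since the ring operations above are also called _+_, _*_ and _∣_.
open import Data.Nat
  using (ℕ; NonZero; zero; suc; _+_; _*_; _^_; _∸_; _/_; _%_; _≤_; _<_; z≤n; s≤s; _≡ᵇ_; parity)
open import Data.Nat.Divisibility using (_∣_)

-- The ring F₂[X]

infix 4 _≋_
record _≋_ (p q : Poly) : Set where
  constructor mk≋
  field coeff-≡ : p ≈ₚ q
open _≋_ public

≋-refl : ∀ {p} → p ≋ p
≋-refl = mk≋ λ _ → refl

≋-sym : ∀ {p q} → p ≋ q → q ≋ p
≋-sym e = mk≋ λ i → sym (coeff-≡ e i)

≋-trans : ∀ {p q r} → p ≋ q → q ≋ r → p ≋ r
≋-trans e f = mk≋ λ i → trans (coeff-≡ e i) (coeff-≡ f i)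

≋-isEquivalence : IsEquivalence _≋_
≋-isEquivalence = record { refl = ≋-refl ; sym = ≋-sym ; trans = ≋-trans }

coeff-+ₚ : ∀ p q i → coeff (p +ₚ q) i ≡ coeff p i xor coeff q i
coeff-+ₚ []      q       i       = refl
coeff-+ₚ (c ∷ p) []      i       = sym (xor-identityʳ _)
coeff-+ₚ (c ∷ p) (d ∷ q) zero    = refl
coeff-+ₚ (c ∷ p) (d ∷ q) (suc i) = coeff-+ₚ p q i

+ₚ-cong : ∀ {p p′ q q′} → p ≋ p′ → q ≋ q′ → (p +ₚ q) ≋ (p′ +ₚ q′)
+ₚ-cong {p} {p′} {q} {q′} e f = mk≋ λ i → begin
  coeff (p +ₚ q) i            ≡⟨ coeff-+ₚ p q i ⟩
  coeff p i xor coeff q i     ≡⟨ cong₂ _xor_ (coeff-≡ e i) (coeff-≡ f i) ⟩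
  coeff p′ i xor coeff q′ i   ≡⟨ coeff-+ₚ p′ q′ i ⟨
  coeff (p′ +ₚ q′) i          ∎
  where open ≡-Reasoning

+ₚ-assoc : ∀ p q r → ((p +ₚ q) +ₚ r) ≋ (p +ₚ (q +ₚ r))
+ₚ-assoc p q r = mk≋ λ i → begin
  coeff ((p +ₚ q) +ₚ r) i                    ≡⟨ coeff-+ₚ (p +ₚ q) r i ⟩
  coeff (p +ₚ q) i xor coeff r i             ≡⟨ cong (_xor coeff r i) (coeff-+ₚ p q i) ⟩
  (coeff p i xor coeff q i) xor coeff r i    ≡⟨ xor-assoc (coeff p i) _ _ ⟩
  coeff p i xor (coeff q i xor coeff r i)    ≡⟨ cong (coeff p i xor_) (coeff-+ₚ q r i) ⟨
  coeff p i xor coeff (q +ₚ r) i             ≡⟨ coeff-+ₚ p (q +ₚ r) i ⟨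
  coeff (p +ₚ (q +ₚ r)) i                    ∎
  where open ≡-Reasoning

+ₚ-comm : ∀ p q → (p +ₚ q) ≋ (q +ₚ p)
+ₚ-comm p q = mk≋ λ i →
  trans (coeff-+ₚ p q i) (trans (xor-comm (coeff p i) _) (sym (coeff-+ₚ q p i)))

+ₚ-identityʳ : ∀ p → (p +ₚ []) ≋ p
+ₚ-identityʳ p = mk≋ λ i → trans (coeff-+ₚ p [] i) (xor-identityʳ _)

+ₚ-self : ∀ p → (p +ₚ p) ≋ []
+ₚ-self p = mk≋ λ i → trans (coeff-+ₚ p p i) (xor-same (coeff p i))

shift : ℕ → (ℕ → Bool) → ℕ → Bool
shift r w i = w (r + i)

⟨_,_⟩ : Poly → (ℕ → Bool) → Bool
⟨ []    , w ⟩ = false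
⟨ c ∷ p , w ⟩ = (c ∧ w 0) xor ⟨ p , w ∘ suc ⟩

infixr 8 _⋆_
_⋆_ : Poly → (ℕ → Bool) → ℕ → Bool
(p ⋆ w) r = ⟨ p , shift r w ⟩

⟨⟩-cong : ∀ p {v w} → v ≗ w → ⟨ p , v ⟩ ≡ ⟨ p , w ⟩
⟨⟩-cong []      e = refl
⟨⟩-cong (c ∷ p) e = cong₂ _xor_ (cong (c ∧_) (e 0)) (⟨⟩-cong p (e ∘ suc))

⋆-cong : ∀ p {v w} → v ≗ w → p ⋆ v ≗ p ⋆ w
⋆-cong p e r = ⟨⟩-cong p (e ∘ (r +_))

⟨⟩-false : ∀ p → ⟨ p , (λ _ → false) ⟩ ≡ false
⟨⟩-false []      = refl
⟨⟩-false (c ∷ p) = cong₂ _xor_ (∧-zeroʳ c) (⟨⟩-false p)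

⟨⟩-+ₚ : ∀ p q w → ⟨ p +ₚ q , w ⟩ ≡ ⟨ p , w ⟩ xor ⟨ q , w ⟩
⟨⟩-+ₚ []      q       w = refl
⟨⟩-+ₚ (c ∷ p) []      w = sym (xor-identityʳ _)
⟨⟩-+ₚ (c ∷ p) (d ∷ q) w = trans
  (cong₂ _xor_ (∧-distribʳ-xor (w 0) c d) (⟨⟩-+ₚ p q (w ∘ suc)))
  (xor-interchange (c ∧ w 0) (d ∧ w 0) _ _)

⟨⟩-xor : ∀ p v w → ⟨ p , (λ i → v i xor w i) ⟩ ≡ ⟨ p , v ⟩ xor ⟨ p , w ⟩
⟨⟩-xor []      v w = refl
⟨⟩-xor (c ∷ p) v w = trans
  (cong₂ _xor_ (∧-distribˡ-xor c (v 0) (w 0)) (⟨⟩-xor p (v ∘ suc) (w ∘ suc)))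
  (xor-interchange (c ∧ v 0) (c ∧ w 0) _ _)

⟨⟩-∧ : ∀ p c w → ⟨ p , (λ i → c ∧ w i) ⟩ ≡ c ∧ ⟨ p , w ⟩
⟨⟩-∧ p false w = ⟨⟩-false p
⟨⟩-∧ p true  w = refl

⟨⟩-applyUpTo-suc : ∀ g j w → ⟨ applyUpTo g (suc j) , w ⟩ ≡ ⟨ applyUpTo g j , w ⟩ xor (g j ∧ w j)
⟨⟩-applyUpTo-suc g zero    w = xor-identityʳ (g 0 ∧ w 0)
⟨⟩-applyUpTo-suc g (suc j) w = trans (cong ((g 0 ∧ w 0) xor_) (⟨⟩-applyUpTo-suc (g ∘ suc) j (w ∘ suc)))
                                     (sym (xor-assoc (g 0 ∧ w 0) _ _))

⟨⟩-≡ᵇ : ∀ p i → ⟨ p , (_≡ᵇ i) ⟩ ≡ coeff p i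
⟨⟩-≡ᵇ []      i       = refl
⟨⟩-≡ᵇ (c ∷ p) zero    = trans (cong₂ _xor_ (∧-identityʳ c) (⟨⟩-false p)) (xor-identityʳ c)
⟨⟩-≡ᵇ (c ∷ p) (suc i) = cong₂ _xor_ (∧-zeroʳ c) (⟨⟩-≡ᵇ p i)

⟨⟩-if : ∀ c q w → ⟨ (if c then q else []) , w ⟩ ≡ c ∧ ⟨ q , w ⟩
⟨⟩-if false q w = refl
⟨⟩-if true  q w = refl

⟨⟩-*ₚ : ∀ p q w → ⟨ p *ₚ q , w ⟩ ≡ ⟨ p , q ⋆ w ⟩
⟨⟩-*ₚ []      q w = refl
⟨⟩-*ₚ (c ∷ p) q w = trans (⟨⟩-+ₚ (if c then q else []) (false ∷ (p *ₚ q)) w)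
                          (cong₂ _xor_ (⟨⟩-if c q w) (⟨⟩-*ₚ p q (w ∘ suc)))

⋆-shift : ∀ q r w → q ⋆ shift r w ≗ shift r (q ⋆ w)
⋆-shift q r w i = ⟨⟩-cong q λ j → cong w (sym (ℕ.+-assoc r i j))

⋆-*ₚ : ∀ p q w → (p *ₚ q) ⋆ w ≗ p ⋆ q ⋆ w
⋆-*ₚ p q w r = trans (⟨⟩-*ₚ p q (shift r w)) (⟨⟩-cong p (⋆-shift q r w))

⋆-∷ : ∀ c p w → (c ∷ p) ⋆ w ≗ (λ r → (c ∧ w r) xor (p ⋆ w ∘ suc) r)
⋆-∷ c p w r = cong₂ _xor_ (cong (λ i → c ∧ w i) (ℕ.+-identityʳ r))
                          (⟨⟩-cong p λ i → cong w (ℕ.+-suc r i))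

-- p ⋆ and q ⋆ commute, which is what makes F₂[X] commutative.
⟨⟩-⋆-comm : ∀ p q w → ⟨ p , q ⋆ w ⟩ ≡ ⟨ q , p ⋆ w ⟩
⟨⟩-⋆-comm []      q w = sym (⟨⟩-false q)
⟨⟩-⋆-comm (c ∷ p) q w = begin
  (c ∧ ⟨ q , w ⟩) xor ⟨ p , q ⋆ w ∘ suc ⟩
    ≡⟨ cong ((c ∧ ⟨ q , w ⟩) xor_) (⟨⟩-⋆-comm p q (w ∘ suc)) ⟩
  (c ∧ ⟨ q , w ⟩) xor ⟨ q , p ⋆ w ∘ suc ⟩
    ≡⟨ cong (_xor ⟨ q , p ⋆ w ∘ suc ⟩) (⟨⟩-∧ q c w) ⟨
  ⟨ q , (λ r → c ∧ w r) ⟩ xor ⟨ q , p ⋆ w ∘ suc ⟩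
    ≡⟨ ⟨⟩-xor q (λ r → c ∧ w r) (p ⋆ w ∘ suc) ⟨
  ⟨ q , (λ r → (c ∧ w r) xor (p ⋆ w ∘ suc) r) ⟩
    ≡⟨ ⟨⟩-cong q (⋆-∷ c p w) ⟨
  ⟨ q , (c ∷ p) ⋆ w ⟩
    ∎
  where open ≡-Reasoning

∷-≋-tail : ∀ {c d p q} → (c ∷ p) ≋ (d ∷ q) → p ≋ q
∷-≋-tail e = mk≋ (coeff-≡ e ∘ suc)

∷-≋[]-tail : ∀ {c p} → (c ∷ p) ≋ [] → p ≋ []
∷-≋[]-tail e = mk≋ (coeff-≡ e ∘ suc)

⟨⟩-≋[] : ∀ {p} → p ≋ [] → ∀ w → ⟨ p , w ⟩ ≡ false
⟨⟩-≋[] {[]}    e w = refl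
⟨⟩-≋[] {c ∷ p} e w with coeff-≡ e 0
... | refl = ⟨⟩-≋[] (∷-≋[]-tail e) (w ∘ suc)

⟨⟩-≋ : ∀ {p q} → p ≋ q → ∀ w → ⟨ p , w ⟩ ≡ ⟨ q , w ⟩
⟨⟩-≋ {[]}    {q}     e w = sym (⟨⟩-≋[] (≋-sym e) w)
⟨⟩-≋ {c ∷ p} {[]}    e w = ⟨⟩-≋[] e w
⟨⟩-≋ {c ∷ p} {d ∷ q} e w with coeff-≡ e 0
... | refl = cong ((c ∧ w 0) xor_) (⟨⟩-≋ (∷-≋-tail e) (w ∘ suc))

-- The pairing separates polynomials, so with ⟨⟩-*ₚ the multiplicative laws of F₂[X]
-- reduce to identities between sequences.
≋-by-⟨⟩ : ∀ {p q} → (∀ w → ⟨ p , w ⟩ ≡ ⟨ q , w ⟩) → p ≋ q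
≋-by-⟨⟩ {p} {q} e = mk≋ λ i → trans (sym (⟨⟩-≡ᵇ p i)) (trans (e (_≡ᵇ i)) (⟨⟩-≡ᵇ q i))

*ₚ-cong : ∀ {p p′ q q′} → p ≋ p′ → q ≋ q′ → (p *ₚ q) ≋ (p′ *ₚ q′)
*ₚ-cong {p} {p′} {q} {q′} e f = ≋-by-⟨⟩ λ w → begin
  ⟨ p *ₚ q , w ⟩      ≡⟨ ⟨⟩-*ₚ p q w ⟩
  ⟨ p , q ⋆ w ⟩       ≡⟨ ⟨⟩-≋ e (q ⋆ w) ⟩
  ⟨ p′ , q ⋆ w ⟩      ≡⟨ ⟨⟩-cong p′ (λ r → ⟨⟩-≋ f (shift r w)) ⟩
  ⟨ p′ , q′ ⋆ w ⟩     ≡⟨ ⟨⟩-*ₚ p′ q′ w ⟨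
  ⟨ p′ *ₚ q′ , w ⟩    ∎
  where open ≡-Reasoning

*ₚ-assoc : ∀ p q r → ((p *ₚ q) *ₚ r) ≋ (p *ₚ (q *ₚ r))
*ₚ-assoc p q r = ≋-by-⟨⟩ λ w → begin
  ⟨ (p *ₚ q) *ₚ r , w ⟩   ≡⟨ ⟨⟩-*ₚ (p *ₚ q) r w ⟩
  ⟨ p *ₚ q , r ⋆ w ⟩      ≡⟨ ⟨⟩-*ₚ p q (r ⋆ w) ⟩
  ⟨ p , q ⋆ r ⋆ w ⟩       ≡⟨ ⟨⟩-cong p (⋆-*ₚ q r w) ⟨
  ⟨ p , (q *ₚ r) ⋆ w ⟩    ≡⟨ ⟨⟩-*ₚ p (q *ₚ r) w ⟨
  ⟨ p *ₚ (q *ₚ r) , w ⟩   ∎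
  where open ≡-Reasoning

*ₚ-comm : ∀ p q → (p *ₚ q) ≋ (q *ₚ p)
*ₚ-comm p q = ≋-by-⟨⟩ λ w →
  trans (⟨⟩-*ₚ p q w) (trans (⟨⟩-⋆-comm p q w) (sym (⟨⟩-*ₚ q p w)))

*ₚ-identityˡ : ∀ p → (oneₚ *ₚ p) ≋ p
*ₚ-identityˡ p = ≋-by-⟨⟩ λ w → trans (⟨⟩-*ₚ oneₚ p w) (xor-identityʳ _)

*ₚ-identityʳ : ∀ p → (p *ₚ oneₚ) ≋ p
*ₚ-identityʳ p = ≋-trans (*ₚ-comm p oneₚ) (*ₚ-identityˡ p)

*ₚ-distribʳ : ∀ p q r → ((q +ₚ r) *ₚ p) ≋ ((q *ₚ p) +ₚ (r *ₚ p))
*ₚ-distribʳ p q r = ≋-by-⟨⟩ λ w → begin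
  ⟨ (q +ₚ r) *ₚ p , w ⟩                    ≡⟨ ⟨⟩-*ₚ (q +ₚ r) p w ⟩
  ⟨ q +ₚ r , p ⋆ w ⟩                       ≡⟨ ⟨⟩-+ₚ q r (p ⋆ w) ⟩
  ⟨ q , p ⋆ w ⟩ xor ⟨ r , p ⋆ w ⟩          ≡⟨ cong₂ _xor_ (⟨⟩-*ₚ q p w) (⟨⟩-*ₚ r p w) ⟨
  ⟨ q *ₚ p , w ⟩ xor ⟨ r *ₚ p , w ⟩        ≡⟨ ⟨⟩-+ₚ (q *ₚ p) (r *ₚ p) w ⟨
  ⟨ (q *ₚ p) +ₚ (r *ₚ p) , w ⟩             ∎
  where open ≡-Reasoning

*ₚ-distribˡ : ∀ p q r → (p *ₚ (q +ₚ r)) ≋ ((p *ₚ q) +ₚ (p *ₚ r))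
*ₚ-distribˡ p q r = ≋-trans (*ₚ-comm p (q +ₚ r))
  (≋-trans (*ₚ-distribʳ p q r) (+ₚ-cong (*ₚ-comm q p) (*ₚ-comm r p)))

F₂[X] : CommutativeRing 0ℓ 0ℓ
F₂[X] = record
  { Carrier = Poly ; _≈_ = _≋_ ; _+_ = _+ₚ_ ; _*_ = _*ₚ_ ; -_ = id ; 0# = [] ; 1# = oneₚ
  ; isCommutativeRing = record
    { isRing = record
      { +-isAbelianGroup = record
        { isGroup = record
          { isMonoid = record
            { isSemigroup = record
              { isMagma = record { isEquivalence = ≋-isEquivalence ; ∙-cong = +ₚ-cong }
              ; assoc = +ₚ-assoc }
            ; identity = (λ _ → ≋-refl) , +ₚ-identityʳ }
          ; inverse = +ₚ-self , +ₚ-self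
          ; ⁻¹-cong = id }
        ; comm = +ₚ-comm }
      ; *-cong = *ₚ-cong
      ; *-assoc = *ₚ-assoc
      ; *-identity = *ₚ-identityˡ , *ₚ-identityʳ
      ; distrib = *ₚ-distribˡ , *ₚ-distribʳ }
    ; *-comm = *ₚ-comm } }

open BezoutCoprimality F₂[X]
open CommutativeRing F₂[X] using (zeroʳ)
open import Algebra.Properties.Semiring.Divisibility (CommutativeRing.semiring F₂[X])
  using (_,_; ∣-respʳ; ∣-refl; _∣0) renaming (_∣_ to _∣ₓ_)




≋-setoid : Setoid 0ℓ 0ℓ
≋-setoid = CommutativeRing.setoid F₂[X]

module ≋-Reasoning = SetoidReasoning ≋-setoid

+ₚ-congˡ : ∀ p {q q′} → q ≋ q′ → (p +ₚ q) ≋ (p +ₚ q′)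
+ₚ-congˡ p = +ₚ-cong (≋-refl {p})

+ₚ-congʳ : ∀ q {p p′} → p ≋ p′ → (p +ₚ q) ≋ (p′ +ₚ q)
+ₚ-congʳ q e = +ₚ-cong e (≋-refl {q})

*ₚ-congˡ : ∀ p {q q′} → q ≋ q′ → (p *ₚ q) ≋ (p *ₚ q′)
*ₚ-congˡ p = *ₚ-cong (≋-refl {p})

*ₚ-congʳ : ∀ q {p p′} → p ≋ p′ → (p *ₚ q) ≋ (p′ *ₚ q)
*ₚ-congʳ q e = *ₚ-cong e (≋-refl {q})

∷-cong : ∀ {c p q} → p ≋ q → (c ∷ p) ≋ (c ∷ q)
∷-cong e = mk≋ λ { zero → refl ; (suc i) → coeff-≡ e i }

+ₚ-cancelʳ : ∀ x y → ((x +ₚ y) +ₚ y) ≋ x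
+ₚ-cancelʳ x y = ≋-trans (+ₚ-assoc x y y) (≋-trans (+ₚ-congˡ x (+ₚ-self y)) (+ₚ-identityʳ x))

∣ₚ⇒∣ₓ : ∀ {d p} → d ∣ₚ p → d ∣ₓ p
∣ₚ⇒∣ₓ {d} (e , de≈p) = e , ≋-trans (*ₚ-comm e d) (mk≋ de≈p)

∣ₓ⇒∣ₚ : ∀ {d p} → d ∣ₓ p → d ∣ₚ p
∣ₓ⇒∣ₚ {d} (e , ed≋p) = e , coeff-≡ (≋-trans (*ₚ-comm d e) ed≋p)

coprime⇒gcdOne : ∀ {p q} → Coprime p q → GcdOne p q
coprime⇒gcdOne {p} {q} c d d∣p d∣q =
  ∣ₓ⇒∣ₚ {d} (coprime⇒∣1 {p} {q} c (∣ₚ⇒∣ₓ {d} {p} d∣p) (∣ₚ⇒∣ₓ {d} {q} d∣q))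

isUnitMod⇔coprime : ∀ M p → IsUnitMod M p ⇔ Coprime p M
isUnitMod⇔coprime M p = mk⇔
  (λ (g , h , pg≈1+hM) → bezout g h (begin
    (p *ₚ g) +ₚ (M *ₚ h)             ≈⟨ +ₚ-cong (mk≋ pg≈1+hM) (*ₚ-comm M h) ⟩
    (oneₚ +ₚ (h *ₚ M)) +ₚ (h *ₚ M)   ≈⟨ +ₚ-cancelʳ oneₚ (h *ₚ M) ⟩
    oneₚ                             ∎))
  (λ (bezout s t ps+Mt≈1) → s , t , coeff-≡ (begin
    p *ₚ s                           ≈⟨ +ₚ-cancelʳ (p *ₚ s) (M *ₚ t) ⟨
    ((p *ₚ s) +ₚ (M *ₚ t)) +ₚ (M *ₚ t) ≈⟨ +ₚ-cong ps+Mt≈1 (*ₚ-comm M t) ⟩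
    oneₚ +ₚ (t *ₚ M)                 ∎))
  where open ≋-Reasoning

⟨⟩-X^ : ∀ k w → ⟨ X^ k , w ⟩ ≡ w k
⟨⟩-X^ zero    w = xor-identityʳ (w 0)
⟨⟩-X^ (suc k) w = ⟨⟩-X^ k (w ∘ suc)

X^-+ : ∀ i j → X^ (i + j) ≋ (X^ i *ₚ X^ j)
X^-+ i j = ≋-by-⟨⟩ λ w → begin
  ⟨ X^ (i + j) , w ⟩       ≡⟨ ⟨⟩-X^ (i + j) w ⟩
  w (i + j)                ≡⟨ ⟨⟩-X^ j (shift i w) ⟨
  ⟨ X^ j , shift i w ⟩     ≡⟨ ⟨⟩-X^ i (X^ j ⋆ w) ⟨
  ⟨ X^ i , X^ j ⋆ w ⟩      ≡⟨ ⟨⟩-*ₚ (X^ i) (X^ j) w ⟨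
  ⟨ X^ i *ₚ X^ j , w ⟩     ∎
  where open ≡-Reasoning


+ₚ-cancel-middle : ∀ x y z → ((x +ₚ y) +ₚ (y +ₚ z)) ≋ (x +ₚ z)
+ₚ-cancel-middle x y z = begin
  (x +ₚ y) +ₚ (y +ₚ z)     ≈⟨ +ₚ-assoc x y (y +ₚ z) ⟩
  x +ₚ (y +ₚ (y +ₚ z))     ≈⟨ +ₚ-congˡ x (+ₚ-assoc y y z) ⟨
  x +ₚ ((y +ₚ y) +ₚ z)     ≈⟨ +ₚ-congˡ x (+ₚ-congʳ z (+ₚ-self y)) ⟩
  x +ₚ z                   ∎
  where open ≋-Reasoning

X^*[1+X^] : ∀ j k → (X^ j *ₚ (oneₚ +ₚ X^ k)) ≋ (X^ j +ₚ X^ (j + k))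
X^*[1+X^] j k = ≋-trans (*ₚ-distribˡ (X^ j) oneₚ (X^ k))
                        (+ₚ-cong (*ₚ-identityʳ (X^ j)) (≋-sym (X^-+ j k)))

X^[h+h]+X^h≋X^h*[1+X^h] : ∀ h → (X^ (h + h) +ₚ X^ h) ≋ (X^ h *ₚ (oneₚ +ₚ X^ h))
X^[h+h]+X^h≋X^h*[1+X^h] h = ≋-trans (+ₚ-comm (X^ (h + h)) (X^ h)) (≋-sym (X^*[1+X^] h h))

-- true ∷ L is 1 + X·L.
coprime-X^ : ∀ L k → Coprime (true ∷ L) (X^ k)
coprime-X^ L zero    =
  bezout [] oneₚ (≋-trans (+ₚ-congʳ (X^ 0 *ₚ oneₚ) (zeroʳ (true ∷ L))) (*ₚ-identityʳ oneₚ))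
coprime-X^ L (suc k) =
  coprime-∣ʳ (coprime-*ʳ coprime-X (coprime-X^ L k)) (oneₚ , ≋-trans (*ₚ-identityˡ _) (X^-+ 1 k))
  where
  coprime-X : Coprime (true ∷ L) (X^ 1)
  coprime-X = bezout oneₚ L (≋-trans (+ₚ-cong (*ₚ-identityʳ (true ∷ L)) (∷-cong (*ₚ-identityˡ L)))
    (mk≋ λ { zero → refl ; (suc i) → trans (coeff-+ₚ L L i) (xor-same (coeff L i)) }))

1+X^-∣ : ∀ {m h} → m ∣ h → (oneₚ +ₚ X^ m) ∣ₓ (oneₚ +ₚ X^ h)
1+X^-∣ {m} (ℕ∣.divides q refl) = go q
  where
  go : ∀ q → (oneₚ +ₚ X^ m) ∣ₓ (oneₚ +ₚ X^ (q * m))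
  go zero    = ∣-respʳ (≋-sym (+ₚ-self oneₚ)) ((oneₚ +ₚ X^ m) ∣0)
  go (suc q) = ∣-respʳ B[m+qm] (∣-linear oneₚ (X^ m) ∣-refl (go q))
    where
    open ≋-Reasoning
    B[m+qm] : ((oneₚ +ₚ X^ m) *ₚ oneₚ) +ₚ ((oneₚ +ₚ X^ (q * m)) *ₚ X^ m) ≋ (oneₚ +ₚ X^ (m + q * m))
    B[m+qm] = begin
      ((oneₚ +ₚ X^ m) *ₚ oneₚ) +ₚ ((oneₚ +ₚ X^ (q * m)) *ₚ X^ m)
        ≈⟨ +ₚ-cong (*ₚ-identityʳ (oneₚ +ₚ X^ m))
                   (≋-trans (*ₚ-comm (oneₚ +ₚ X^ (q * m)) (X^ m)) (X^*[1+X^] m (q * m))) ⟩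
      (oneₚ +ₚ X^ m) +ₚ (X^ m +ₚ X^ (m + q * m))
        ≈⟨ +ₚ-cancel-middle oneₚ (X^ m) (X^ (m + q * m)) ⟩
      oneₚ +ₚ X^ (m + q * m) ∎

-- Division with remainder and Euclid's algorithm in F₂[X]

DegreeBelow : ℕ → Poly → Set
DegreeBelow L p = ∀ i → L ≤ i → coeff p i ≡ false

HasDegree : ℕ → Poly → Set
HasDegree l p = coeff p l ≡ true × DegreeBelow (suc l) p

degreeBelow-length : ∀ p → DegreeBelow (length p) p
degreeBelow-length []      i       _         = refl
degreeBelow-length (c ∷ p) (suc i) (s≤s le) = degreeBelow-length p i le

degreeBelow-mono : ∀ {L L′} p → L ≤ L′ → DegreeBelow L p → DegreeBelow L′ p
degreeBelow-mono p L≤L′ d i L′≤i = d i (ℕ.≤-trans L≤L′ L′≤i)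

degreeBelow-0 : ∀ p → DegreeBelow 0 p → p ≋ []
degreeBelow-0 p d = mk≋ λ i → d i z≤n

degreeBelow-pred : ∀ {L} p → DegreeBelow (suc L) p → coeff p L ≡ false → DegreeBelow L p
degreeBelow-pred p d top i L≤i with ℕ.m≤n⇒m<n∨m≡n L≤i
... | inj₁ L<i = d i L<i
... | inj₂ refl = top

degreeBelow-+ₚ : ∀ {L} p q → DegreeBelow L p → DegreeBelow L q → DegreeBelow L (p +ₚ q)
degreeBelow-+ₚ p q dp dq i L≤i = trans (coeff-+ₚ p q i) (cong₂ _xor_ (dp i L≤i) (dq i L≤i))

coeff-X^*ₚ : ∀ k p i → coeff (X^ k *ₚ p) (k + i) ≡ coeff p i
coeff-X^*ₚ zero    p i = coeff-≡ (*ₚ-identityˡ p) i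
coeff-X^*ₚ (suc k) p i = coeff-X^*ₚ k p i

degreeBelow-X^*ₚ : ∀ {L} k p → DegreeBelow L p → DegreeBelow (k + L) (X^ k *ₚ p)
degreeBelow-X^*ₚ zero    p d i       L≤i       = trans (coeff-≡ (*ₚ-identityˡ p) i) (d i L≤i)
degreeBelow-X^*ₚ (suc k) p d (suc i) (s≤s k+L≤i) = degreeBelow-X^*ₚ k p d i k+L≤i

degree-or-zero : ∀ L p → DegreeBelow L p → p ≋ [] ⊎ ∃ λ l → l < L × HasDegree l p
degree-or-zero zero    p d = inj₁ (degreeBelow-0 p d)
degree-or-zero (suc L) p d with coeff p L in top
... | true  = inj₂ (L , ℕ.≤-refl , top , d)
... | false with degree-or-zero L p (degreeBelow-pred p d top)
...   | inj₁ p≋0             = inj₁ p≋0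
...   | inj₂ (l , l<L , deg) = inj₂ (l , ℕ.m<n⇒m<1+n l<L , deg)

record Division (p d : Poly) (l : ℕ) : Set where
  constructor division
  field
    quotient remainder : Poly
    identity           : p ≋ ((quotient *ₚ d) +ₚ remainder)
    remainder-degree   : DegreeBelow l remainder

-- Cancel the top coefficient of p against X^k·d and recurse.
divide : ∀ L p d {l} → HasDegree l d → DegreeBelow L p → Division p d l
divide L p d {l} deg-d dp with L ℕ.≤? l
... | yes L≤l = division [] p ≋-refl (degreeBelow-mono p L≤l dp)
divide zero    p d deg-d dp | no 0≰l = contradiction z≤n 0≰l
divide (suc L) p d {l} (top-d , below-d) dp | no L<l with coeff p L in top-p
... | false = divide L p d (top-d , below-d) (degreeBelow-pred p dp top-p)
... | true  = reduce (divide L p′ d (top-d , below-d) p′-degree)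
  where
  l≤L = ℕ.≤-pred (ℕ.≰⇒> L<l)
  k   = L ∸ l
  k+l≡L : k + l ≡ L
  k+l≡L = ℕ.m∸n+n≡m l≤L
  p′ = p +ₚ (X^ k *ₚ d)
  p′-degree : DegreeBelow L p′
  p′-degree = degreeBelow-pred p′
    (degreeBelow-+ₚ p (X^ k *ₚ d) dp
      (subst (λ j → DegreeBelow j (X^ k *ₚ d)) (trans (ℕ.+-suc k l) (cong suc k+l≡L))
             (degreeBelow-X^*ₚ k d below-d)))
    (begin
      coeff p′ L                            ≡⟨ coeff-+ₚ p (X^ k *ₚ d) L ⟩
      coeff p L xor coeff (X^ k *ₚ d) L     ≡⟨ cong₂ _xor_ top-p (cong (coeff (X^ k *ₚ d)) (sym k+l≡L)) ⟩
      true xor coeff (X^ k *ₚ d) (k + l)    ≡⟨ cong (true xor_) (trans (coeff-X^*ₚ k d l) top-d) ⟩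
      false                                 ∎)
    where open ≡-Reasoning
  reduce : Division p′ d l → Division p d l
  reduce (division q r p′≋qd+r dr) = division (q +ₚ X^ k) r (begin
    p                                        ≈⟨ +ₚ-cancelʳ p (X^ k *ₚ d) ⟨
    p′ +ₚ (X^ k *ₚ d)                        ≈⟨ +ₚ-congʳ (X^ k *ₚ d) p′≋qd+r ⟩
    ((q *ₚ d) +ₚ r) +ₚ (X^ k *ₚ d)           ≈⟨ +ₚ-assoc (q *ₚ d) r (X^ k *ₚ d) ⟩
    (q *ₚ d) +ₚ (r +ₚ (X^ k *ₚ d))           ≈⟨ +ₚ-congˡ (q *ₚ d) (+ₚ-comm r (X^ k *ₚ d)) ⟩
    (q *ₚ d) +ₚ ((X^ k *ₚ d) +ₚ r)           ≈⟨ +ₚ-assoc (q *ₚ d) (X^ k *ₚ d) r ⟨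
    ((q *ₚ d) +ₚ (X^ k *ₚ d)) +ₚ r           ≈⟨ +ₚ-congʳ r (*ₚ-distribʳ d q (X^ k)) ⟨
    ((q +ₚ X^ k) *ₚ d) +ₚ r                  ∎) dr
    where open ≋-Reasoning

record CommonDivisorCombination (p q : Poly) : Set where
  constructor common
  field
    divisor        : Poly
    divisor-∣ˡ     : divisor ∣ₓ p
    divisor-∣ʳ     : divisor ∣ₓ q
    s t            : Poly
    identity       : ((p *ₚ s) +ₚ (q *ₚ t)) ≋ divisor

euclid : ∀ L p q → DegreeBelow L q → CommonDivisorCombination p q
euclid L p q dq with degree-or-zero L q dq
... | inj₁ q≋0 = common p ∣-refl (∣-respʳ (≋-sym q≋0) (p ∣0)) oneₚ [] (begin
  (p *ₚ oneₚ) +ₚ (q *ₚ [])    ≈⟨ +ₚ-cong (*ₚ-identityʳ p) (zeroʳ q) ⟩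
  p +ₚ []                     ≈⟨ +ₚ-identityʳ p ⟩
  p                           ∎)
  where open ≋-Reasoning
euclid (suc L) p q dq | inj₂ (l , s≤s l≤L , deg-q)
  with divide (length p) p q deg-q (degreeBelow-length p)
... | division Q r p≋Qq+r dr with euclid L q r (degreeBelow-mono r l≤L dr)
...   | common g g∣q g∣r s t qs+rt≋g = common g g∣p g∣q t (s +ₚ (Q *ₚ t)) (begin
  (p *ₚ t) +ₚ (q *ₚ (s +ₚ (Q *ₚ t)))
    ≈⟨ +ₚ-cong pt≋rt+Qqt (≋-trans (*ₚ-distribˡ q s (Q *ₚ t)) (+ₚ-comm (q *ₚ s) (q *ₚ (Q *ₚ t)))) ⟩
  ((r *ₚ t) +ₚ ((Q *ₚ q) *ₚ t)) +ₚ ((q *ₚ (Q *ₚ t)) +ₚ (q *ₚ s))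
    ≈⟨ +ₚ-congˡ ((r *ₚ t) +ₚ ((Q *ₚ q) *ₚ t)) (+ₚ-congʳ (q *ₚ s) q[Qt]≋Qq[t]) ⟩
  ((r *ₚ t) +ₚ ((Q *ₚ q) *ₚ t)) +ₚ (((Q *ₚ q) *ₚ t) +ₚ (q *ₚ s))
    ≈⟨ +ₚ-cancel-middle (r *ₚ t) ((Q *ₚ q) *ₚ t) (q *ₚ s) ⟩
  (r *ₚ t) +ₚ (q *ₚ s)
    ≈⟨ +ₚ-comm (r *ₚ t) (q *ₚ s) ⟩
  (q *ₚ s) +ₚ (r *ₚ t)
    ≈⟨ qs+rt≋g ⟩
  g ∎)
  where
  open ≋-Reasoning
  g∣p : g ∣ₓ p
  g∣p = ∣-respʳ (≋-trans (+ₚ-cong (*ₚ-comm q Q) (*ₚ-identityʳ r)) (≋-sym p≋Qq+r))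
                (∣-linear Q oneₚ g∣q g∣r)
  q[Qt]≋Qq[t] : (q *ₚ (Q *ₚ t)) ≋ ((Q *ₚ q) *ₚ t)
  q[Qt]≋Qq[t] = ≋-trans (≋-sym (*ₚ-assoc q Q t)) (*ₚ-congʳ t (*ₚ-comm q Q))
  pt≋rt+Qqt : (p *ₚ t) ≋ ((r *ₚ t) +ₚ ((Q *ₚ q) *ₚ t))
  pt≋rt+Qqt = begin
    p *ₚ t                           ≈⟨ *ₚ-congʳ t p≋Qq+r ⟩
    ((Q *ₚ q) +ₚ r) *ₚ t             ≈⟨ *ₚ-distribʳ t (Q *ₚ q) r ⟩
    ((Q *ₚ q) *ₚ t) +ₚ (r *ₚ t)      ≈⟨ +ₚ-comm ((Q *ₚ q) *ₚ t) (r *ₚ t) ⟩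
    (r *ₚ t) +ₚ ((Q *ₚ q) *ₚ t)      ∎

gcdOne⇒coprime : ∀ {p q} → GcdOne p q → Coprime p q
gcdOne⇒coprime {p} {q} one with euclid (length q) p q (degreeBelow-length q)
... | common g g∣p g∣q s t ps+qt≋g with ∣ₚ⇒∣ₓ {g} {oneₚ} (one g (∣ₓ⇒∣ₚ {g} {p} g∣p) (∣ₓ⇒∣ₚ {g} {q} g∣q))
...   | e , eg≋1 = bezout (s *ₚ e) (t *ₚ e) (begin
  (p *ₚ (s *ₚ e)) +ₚ (q *ₚ (t *ₚ e))   ≈⟨ +ₚ-cong (*ₚ-assoc p s e) (*ₚ-assoc q t e) ⟨
  ((p *ₚ s) *ₚ e) +ₚ ((q *ₚ t) *ₚ e)   ≈⟨ *ₚ-distribʳ e (p *ₚ s) (q *ₚ t) ⟨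
  ((p *ₚ s) +ₚ (q *ₚ t)) *ₚ e          ≈⟨ *ₚ-congʳ e ps+qt≋g ⟩
  g *ₚ e                               ≈⟨ *ₚ-comm g e ⟩
  e *ₚ g                               ≈⟨ eg≋1 ⟩
  oneₚ                                 ∎)
  where open ≋-Reasoning

-- Periodic sequences annihilated by a polynomial

Periodic : ℕ → (ℕ → Bool) → Set
Periodic h v = ∀ r → v (h + r) ≡ v r

KernelTrivial : Poly → ℕ → Set
KernelTrivial p h = ∀ u → Periodic h u → (∀ r → (p ⋆ u) r ≡ false) → ∀ r → u r ≡ false

periodic-+* : ∀ {n} X → Periodic n X → ∀ k r → X (k * n + r) ≡ X r
periodic-+*         X per zero    r = refl
periodic-+* {n} X per (suc k) r =
  trans (cong X (ℕ.+-assoc n (k * n) r)) (trans (per (k * n + r)) (periodic-+* X per k r))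

periodic-% : ∀ n .{{_ : NonZero n}} X → Periodic n X → ∀ r → X (r % n) ≡ X r
periodic-% n X per r = trans (sym (periodic-+* X per (r / n) (r % n)))
  (cong X (trans (ℕ.+-comm ((r / n) * n) (r % n)) (sym (m≡m%n+[m/n]*n r n))))

⋆-periodic : ∀ p {h v} → Periodic h v → Periodic h (p ⋆ v)
⋆-periodic p {h} {v} per r = ⟨⟩-cong p λ i → trans (cong v (ℕ.+-assoc h r i)) (per (r + i))

⋆-≋ : ∀ {p q} → p ≋ q → ∀ v → p ⋆ v ≗ q ⋆ v
⋆-≋ p≋q v r = ⟨⟩-≋ p≋q (shift r v)

⋆-+ₚ : ∀ p q v → (p +ₚ q) ⋆ v ≗ (λ r → (p ⋆ v) r xor (q ⋆ v) r)
⋆-+ₚ p q v r = ⟨⟩-+ₚ p q (shift r v)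

oneₚ-⋆ : ∀ v → oneₚ ⋆ v ≗ v
oneₚ-⋆ v r = trans (⟨⟩-X^ 0 (shift r v)) (cong v (ℕ.+-identityʳ r))

⋆-annihilates : ∀ q {v} → (∀ r → v r ≡ false) → ∀ r → (q ⋆ v) r ≡ false
⋆-annihilates q v≡0 r = trans (⟨⟩-cong q (v≡0 ∘ (r +_))) (⟨⟩-false q)

*ₚ-annihilates : ∀ q p {v} → (∀ r → (p ⋆ v) r ≡ false) → ∀ r → ((q *ₚ p) ⋆ v) r ≡ false
*ₚ-annihilates q p {v} p⋆v≡0 r = trans (⋆-*ₚ q p v r) (⋆-annihilates q {p ⋆ v} p⋆v≡0 r)

1+X^-annihilates-periodic : ∀ h {v} → Periodic h v → ∀ r → ((oneₚ +ₚ X^ h) ⋆ v) r ≡ false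
1+X^-annihilates-periodic h {v} per r = begin
  ((oneₚ +ₚ X^ h) ⋆ v) r                 ≡⟨ ⋆-+ₚ oneₚ (X^ h) v r ⟩
  (oneₚ ⋆ v) r xor (X^ h ⋆ v) r          ≡⟨ cong₂ _xor_ (oneₚ-⋆ v r) (⟨⟩-X^ h (shift r v)) ⟩
  v r xor v (r + h)                      ≡⟨ cong (v r xor_) (trans (cong v (ℕ.+-comm r h)) (per r)) ⟩
  v r xor v r                            ≡⟨ xor-same (v r) ⟩
  false                                  ∎
  where open ≡-Reasoning

coprime⇒kernelTrivial : ∀ {p h} → Coprime p (oneₚ +ₚ X^ h) → KernelTrivial p h
coprime⇒kernelTrivial {p} {h} (bezout s t ps+Bt≋1) u per p⋆u≡0 r = begin
  u r                                          ≡⟨ oneₚ-⋆ u r ⟨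
  (oneₚ ⋆ u) r                                 ≡⟨ ⋆-≋ ps+Bt≋1 u r ⟨
  (((p *ₚ s) +ₚ (B *ₚ t)) ⋆ u) r               ≡⟨ ⋆-+ₚ (p *ₚ s) (B *ₚ t) u r ⟩
  ((p *ₚ s) ⋆ u) r xor ((B *ₚ t) ⋆ u) r
    ≡⟨ cong₂ _xor_ (vanish p s p⋆u≡0) (vanish B t (1+X^-annihilates-periodic h per)) ⟩
  false                                        ∎
  where
  open ≡-Reasoning
  B = oneₚ +ₚ X^ h
  vanish : ∀ a c → (∀ r → (a ⋆ u) r ≡ false) → ((a *ₚ c) ⋆ u) r ≡ false
  vanish a c a⋆u≡0 = trans (⋆-≋ (*ₚ-comm a c) u r) (*ₚ-annihilates c a {u} a⋆u≡0 r)

δ : ℕ → ℕ → Bool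
δ h r = does (h ℕ∣.∣? r)

δ-periodic : ∀ h → Periodic h (δ h)
δ-periodic h r = does-⇔
  (mk⇔ (λ h∣h+r → ℕ∣.∣m+n∣m⇒∣n h∣h+r ℕ∣.∣-refl) (ℕ∣.∣m∣n⇒∣m+n ℕ∣.∣-refl))
  (h ℕ∣.∣? (h + r)) (h ℕ∣.∣? r)

δ-self : ∀ h → δ h h ≡ true
δ-self h = dec-true (h ℕ∣.∣? h) ℕ∣.∣-refl

δ-below : ∀ {h x} → 0 < x → x < h → δ h x ≡ false
δ-below {h} {suc x} _ x<h = dec-false (h ℕ∣.∣? suc x) λ h∣x → ℕ.<⇒≱ x<h (ℕ∣.∣⇒≤ h∣x)

≡ᵇ-refl : ∀ n → (n ≡ᵇ n) ≡ true
≡ᵇ-refl zero    = refl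
≡ᵇ-refl (suc n) = ≡ᵇ-refl n

<⇒≡ᵇ-false : ∀ {m n} → m < n → (m ≡ᵇ n) ≡ false
<⇒≡ᵇ-false {zero}  {suc n} _         = refl
<⇒≡ᵇ-false {suc m} {suc n} (s≤s m<n) = <⇒≡ᵇ-false m<n

⟨⟩-local : ∀ L p {v w} → DegreeBelow L p → (∀ j → j < L → v j ≡ w j) → ⟨ p , v ⟩ ≡ ⟨ p , w ⟩
⟨⟩-local L       []      d agree = refl
⟨⟩-local zero    (c ∷ p) {v} {w} d agree =
  trans (⟨⟩-≋[] (degreeBelow-0 (c ∷ p) d) v) (sym (⟨⟩-≋[] (degreeBelow-0 (c ∷ p) d) w))
⟨⟩-local (suc L) (c ∷ p) d agree = cong₂ _xor_ (cong (c ∧_) (agree 0 (s≤s z≤n)))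
  (⟨⟩-local L p (λ i L≤i → d (suc i) (s≤s L≤i)) (λ j j<L → agree (suc j) (s≤s j<L)))

-- A polynomial of degree l < h is read off at position h ∸ l of p ⋆ δ h.
degreeBelow-⋆δ≡0⇒≋[] : ∀ h p → DegreeBelow h p → (∀ r → (p ⋆ δ h) r ≡ false) → p ≋ []
degreeBelow-⋆δ≡0⇒≋[] h p dp p⋆δ≡0 with degree-or-zero h p dp
... | inj₁ p≋0 = p≋0
... | inj₂ (l , l<h , top , below) = contradiction (begin
  true                            ≡⟨ top ⟨
  coeff p l                       ≡⟨ ⟨⟩-≡ᵇ p l ⟨
  ⟨ p , (_≡ᵇ l) ⟩                 ≡⟨ ⟨⟩-local (suc l) p below agree ⟩
  (p ⋆ δ h) (h ∸ l)               ≡⟨ p⋆δ≡0 (h ∸ l) ⟩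
  false                           ∎) λ ()
  where
  open ≡-Reasoning
  h∸l+l≡h : h ∸ l + l ≡ h
  h∸l+l≡h = ℕ.m∸n+n≡m (ℕ.<⇒≤ l<h)
  agree : ∀ j → j < suc l → (j ≡ᵇ l) ≡ δ h (h ∸ l + j)
  agree j j≤l with ℕ.m≤n⇒m<n∨m≡n (ℕ.≤-pred j≤l)
  ... | inj₂ refl = trans (≡ᵇ-refl j) (sym (trans (cong (δ h) h∸l+l≡h) (δ-self h)))
  ... | inj₁ j<l  = trans (<⇒≡ᵇ-false j<l) (sym (δ-below
    (ℕ.<-≤-trans (ℕ.m<n⇒0<n∸m l<h) (ℕ.m≤m+n (h ∸ l) j))
    (subst (h ∸ l + j <_) h∸l+l≡h (ℕ.+-monoʳ-< (h ∸ l) j<l))))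

coeff-X^-self : ∀ k → coeff (X^ k) k ≡ true
coeff-X^-self zero    = refl
coeff-X^-self (suc k) = coeff-X^-self k

coeff-X^-> : ∀ {k i} → k < i → coeff (X^ k) i ≡ false
coeff-X^-> {zero}  {suc i} _         = refl
coeff-X^-> {suc k} {suc i} (s≤s k<i) = coeff-X^-> k<i

1+X^-degree : ∀ h′ → HasDegree (suc h′) (oneₚ +ₚ X^ (suc h′))
1+X^-degree h′ = coeff-X^-self h′ , λ { (suc i) (s≤s h′<i) → coeff-X^-> h′<i }

⋆δ≡0⇒1+X^∣ : ∀ h′ e → (∀ r → (e ⋆ δ (suc h′)) r ≡ false) → (oneₚ +ₚ X^ (suc h′)) ∣ₓ e
⋆δ≡0⇒1+X^∣ h′ e e⋆δ≡0
  with divide (length e) e (oneₚ +ₚ X^ (suc h′)) (1+X^-degree h′) (degreeBelow-length e)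
... | division Q r e≋QB+r dr = Q , (begin
  Q *ₚ B             ≈⟨ +ₚ-identityʳ (Q *ₚ B) ⟨
  (Q *ₚ B) +ₚ []     ≈⟨ +ₚ-congˡ (Q *ₚ B) r≋0 ⟨
  (Q *ₚ B) +ₚ r      ≈⟨ e≋QB+r ⟨
  e                  ∎)
  where
  open ≋-Reasoning
  B = oneₚ +ₚ X^ (suc h′)
  r≋e+QB : r ≋ (e +ₚ (Q *ₚ B))
  r≋e+QB = begin
    r                          ≈⟨ +ₚ-cancelʳ r (Q *ₚ B) ⟨
    (r +ₚ (Q *ₚ B)) +ₚ (Q *ₚ B) ≈⟨ +ₚ-congʳ (Q *ₚ B) (≋-trans (+ₚ-comm r (Q *ₚ B)) (≋-sym e≋QB+r)) ⟩
    e +ₚ (Q *ₚ B)              ∎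
  r⋆δ≡0 : ∀ r₀ → (r ⋆ δ (suc h′)) r₀ ≡ false
  r⋆δ≡0 r₀ = trans (⋆-≋ r≋e+QB (δ (suc h′)) r₀) (trans (⋆-+ₚ e (Q *ₚ B) (δ (suc h′)) r₀)
    (cong₂ _xor_ (e⋆δ≡0 r₀) (*ₚ-annihilates Q B {δ (suc h′)}
      (1+X^-annihilates-periodic (suc h′) (δ-periodic (suc h′))) r₀)))
  r≋0 : r ≋ []
  r≋0 = degreeBelow-⋆δ≡0⇒≋[] (suc h′) r dr r⋆δ≡0

true∷-cancel : ∀ q z → ((true ∷ q) *ₚ z) ≋ [] → z ≋ []
true∷-cancel q z qz≋0 = mk≋ λ i → go i z qz≋0
  where
  annihilated-*ₚ : ∀ z → ((true ∷ q) *ₚ z) ≋ [] → ((true ∷ q) *ₚ (q *ₚ z)) ≋ []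
  annihilated-*ₚ z e = begin
    (true ∷ q) *ₚ (q *ₚ z)     ≈⟨ *ₚ-assoc (true ∷ q) q z ⟨
    ((true ∷ q) *ₚ q) *ₚ z     ≈⟨ *ₚ-congʳ z (*ₚ-comm (true ∷ q) q) ⟩
    (q *ₚ (true ∷ q)) *ₚ z     ≈⟨ *ₚ-assoc q (true ∷ q) z ⟩
    q *ₚ ((true ∷ q) *ₚ z)     ≈⟨ *ₚ-congˡ q e ⟩
    q *ₚ []                    ≈⟨ zeroʳ q ⟩
    []                         ∎
    where open ≋-Reasoning
  -- (true ∷ q) *ₚ z reduces to z +ₚ (false ∷ (q *ₚ z)), i.e. (1 + X·q)·z = z + X·(q·z).
  go : ∀ i z → ((true ∷ q) *ₚ z) ≋ [] → coeff z i ≡ false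
  go i z e = trans (sym (xor-identityʳ (coeff z i)))
    (trans (cong (coeff z i xor_) (sym (shifted i)))
           (trans (sym (coeff-+ₚ z (false ∷ (q *ₚ z)) i)) (coeff-≡ e i)))
    where
    shifted : ∀ i → coeff (false ∷ (q *ₚ z)) i ≡ false
    shifted zero    = refl
    shifted (suc i) = go i (q *ₚ z) (annihilated-*ₚ z e)

-- For a common divisor d of p and B = d·e, the sequence e ⋆ δ is annihilated by p,
-- so it vanishes; then B ∣ e, and cancelling B from B = d·e shows d ∣ 1.
kernelTrivial⇒gcdOne : ∀ p h′ → KernelTrivial p (suc h′) → GcdOne p (oneₚ +ₚ X^ (suc h′))
kernelTrivial⇒gcdOne p h′ kernel d (c , dc≈p) (e , de≈B) with ⋆δ≡0⇒1+X^∣ h′ e u≡0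
  where
  h = suc h′
  B = oneₚ +ₚ X^ h
  pe≋cB : (p *ₚ e) ≋ (c *ₚ B)
  pe≋cB = ≋-trans (*ₚ-congʳ e (≋-trans (≋-sym (mk≋ {d *ₚ c} {p} dc≈p)) (*ₚ-comm d c)))
                  (≋-trans (*ₚ-assoc c d e) (*ₚ-congˡ c (mk≋ de≈B)))
  p⋆e⋆δ≡0 : ∀ r → (p ⋆ e ⋆ δ h) r ≡ false
  p⋆e⋆δ≡0 r = trans (sym (⋆-*ₚ p e (δ h) r)) (trans (⋆-≋ pe≋cB (δ h) r)
    (*ₚ-annihilates c B {δ h} (1+X^-annihilates-periodic h (δ-periodic h)) r))
  u≡0 : ∀ r → (e ⋆ δ h) r ≡ false
  u≡0 = kernel (e ⋆ δ h) (⋆-periodic e {h} (δ-periodic h)) p⋆e⋆δ≡0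
... | e′ , e′B≋e = e′ , coeff-≡ (begin
  d *ₚ e′                          ≈⟨ +ₚ-cancelʳ (d *ₚ e′) oneₚ ⟨
  ((d *ₚ e′) +ₚ oneₚ) +ₚ oneₚ      ≈⟨ +ₚ-congʳ oneₚ (≋-trans (+ₚ-comm (d *ₚ e′) oneₚ) 1+de′≋0) ⟩
  oneₚ                             ∎)
  where
  open ≋-Reasoning
  B = oneₚ +ₚ X^ (suc h′)
  B[1+de′]≋0 : (B *ₚ (oneₚ +ₚ (d *ₚ e′))) ≋ []
  B[1+de′]≋0 = begin
    B *ₚ (oneₚ +ₚ (d *ₚ e′))            ≈⟨ *ₚ-distribˡ B oneₚ (d *ₚ e′) ⟩
    (B *ₚ oneₚ) +ₚ (B *ₚ (d *ₚ e′))     ≈⟨ +ₚ-cong (*ₚ-identityʳ B) B[de′]≋B ⟩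
    B +ₚ B                              ≈⟨ +ₚ-self B ⟩
    []                                  ∎
    where
    B[de′]≋B : (B *ₚ (d *ₚ e′)) ≋ B
    B[de′]≋B = begin
      B *ₚ (d *ₚ e′)     ≈⟨ *ₚ-congˡ B (*ₚ-comm d e′) ⟩
      B *ₚ (e′ *ₚ d)     ≈⟨ *ₚ-assoc B e′ d ⟨
      (B *ₚ e′) *ₚ d     ≈⟨ *ₚ-congʳ d (≋-trans (*ₚ-comm B e′) e′B≋e) ⟩
      e *ₚ d             ≈⟨ *ₚ-comm e d ⟩
      d *ₚ e             ≈⟨ mk≋ de≈B ⟩
      B                  ∎
  1+de′≋0 : (oneₚ +ₚ (d *ₚ e′)) ≋ []
  1+de′≋0 = true∷-cancel (X^ h′) (oneₚ +ₚ (d *ₚ e′)) B[1+de′]≋0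

-- Ones of a sequence

2*suc : ∀ s → 2 * suc s ≡ suc (suc (2 * s))
2*suc = solve-∀

2*-+-suc : ∀ s t → 2 * (suc s + t) ≡ 2 * s + 2 * suc t
2*-+-suc = solve-∀

suc-2*-+ : ∀ s t → suc (2 * (s + t)) ≡ 2 * s + suc (2 * t)
suc-2*-+ = solve-∀

2*[h+r] : ∀ h r → 2 * (h + r) ≡ (h + h) + 2 * r
2*[h+r] = solve-∀

parity-2* : ∀ s → parity (2 * s) ≡ 0ℙ
parity-2* s = ℙ.*-homo-* 2 s

parity-suc-2* : ∀ s → parity (suc (2 * s)) ≡ 1ℙ
parity-suc-2* s = trans (ℙ.+-homo-+ 1 (2 * s)) (cong (1ℙ +ℙ_) (parity-2* s))

even-or-odd : ∀ n → (∃ λ s → n ≡ 2 * s) ⊎ (∃ λ s → n ≡ suc (2 * s))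
even-or-odd zero    = inj₁ (0 , refl)
even-or-odd (suc n) with even-or-odd n
... | inj₁ (s , refl) = inj₂ (s , refl)
... | inj₂ (s , refl) = inj₁ (suc s , sym (2*suc s))

odd-parity : ∀ {n} → parity n ≡ 1ℙ → ∃ λ s → n ≡ suc (2 * s)
odd-parity {n} pn with even-or-odd n
... | inj₂ odd          = odd
... | inj₁ (s , refl) = contradiction (trans (sym (parity-2* s)) pn) λ ()

xor-cancelʳ : ∀ x y z → x xor z ≡ y xor z → x ≡ y
xor-cancelʳ x y false e = trans (sym (xor-identityʳ x)) (trans e (xor-identityʳ y))
xor-cancelʳ x y true  e = not-injective (trans (xor-comm true x) (trans e (xor-comm y true)))

least-true : ∀ (f : ℕ → Bool) N → f N ≡ true →
             ∃ λ m → m ≤ N × f m ≡ true × (∀ j → j < m → f j ≡ false)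
least-true f N fN with f 0 in f0
... | true  = 0 , z≤n , f0 , λ _ ()
least-true f zero    fN | false = contradiction (trans (sym f0) fN) λ ()
least-true f (suc N) fN | false with least-true (f ∘ suc) N fN
... | m , m≤N , fm , below = suc m , s≤s m≤N , fm , λ
  { zero    _         → f0
  ; (suc j) (s≤s j<m) → below j j<m }

greatest-true : ∀ (f : ℕ → Bool) N → f 0 ≡ true →
                ∃ λ m → m ≤ N × f m ≡ true × (∀ j → m < j → j ≤ N → f j ≡ false)
greatest-true f zero    f0 = 0 , z≤n , f0 , λ j 0<j j≤0 → contradiction (ℕ.<-≤-trans 0<j j≤0) λ ()
greatest-true f (suc N) f0 with f (suc N) in fN
... | true  = suc N , ℕ.≤-refl , fN , λ j N<j j≤N → contradiction (ℕ.<-≤-trans N<j j≤N) (ℕ.<-irrefl refl)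
... | false with greatest-true f N f0
...   | m , m≤N , fm , above = m , ℕ.m≤n⇒m≤1+n m≤N , fm , λ j m<j j≤1+N →
  [ (λ j≤N → above j m<j (ℕ.≤-pred j≤N)) , (λ { refl → fN }) ]′ (ℕ.m≤n⇒m<n∨m≡n j≤1+N)

record FirstOneAt (X : ℕ → Bool) (d : ℕ) : Set where
  constructor firstOne
  field
    positive : 1 ≤ d
    one      : X d ≡ true
    zeros    : ∀ l → 1 ≤ l → l < d → X l ≡ false

record OddGap (X : ℕ → Bool) : Set where
  constructor oddGap
  field
    half  : ℕ
    first : FirstOneAt X (suc (2 * half))

firstOneAt-cong : ∀ {X Y d} → X ≗ Y → FirstOneAt X d → FirstOneAt Y d
firstOneAt-cong X≗Y (firstOne pos one zeros) =
  firstOne pos (trans (sym (X≗Y _)) one) λ l 1≤l l<d → trans (sym (X≗Y l)) (zeros l 1≤l l<d)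

oddGap-cong : ∀ {X Y} → X ≗ Y → OddGap X → OddGap Y
oddGap-cong X≗Y (oddGap D first) = oddGap D (firstOneAt-cong X≗Y first)

firstOneAt-unique : ∀ {X d d′} → FirstOneAt X d → FirstOneAt X d′ → d ≡ d′
firstOneAt-unique {d = d} {d′} (firstOne pos one zeros) (firstOne pos′ one′ zeros′)
  with ℕ.<-cmp d d′
... | tri< d<d′ _ _ = contradiction (trans (sym one) (zeros′ d pos d<d′)) λ ()
... | tri≈ _ d≡d′ _ = d≡d′
... | tri> _ _ d′<d = contradiction (trans (sym one′) (zeros d′ pos′ d′<d)) λ ()

first-one-upto : ∀ X {d₀} → 1 ≤ d₀ → X d₀ ≡ true → ∃ λ d → d ≤ d₀ × FirstOneAt X d
first-one-upto X {suc d₀} _ one with least-true (X ∘ suc) d₀ one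
... | m , m≤d₀ , one-m , below = suc m , s≤s m≤d₀ , firstOne (s≤s z≤n) one-m
  λ { (suc j) _ (s≤s j<m) → below j j<m }

OddAhead : (ℕ → Bool) → Set
OddAhead X = ∀ c → ∃ λ s → X (c + suc (2 * s)) ≡ true

oddAhead-shift : ∀ X p → OddAhead X → OddAhead (shift p X)
oddAhead-shift X p ahead c with ahead (p + c)
... | s , one = s , trans (cong X (sym (ℕ.+-assoc p c (suc (2 * s))))) one

first-one : ∀ X → OddAhead X → ∃ (FirstOneAt X)
first-one X ahead with ahead 0
... | s , one with first-one-upto X (s≤s z≤n) one
...   | d , _ , first = d , first

-- From a 1 at c: the first 1 at odd offset c + 2s₀ + 1, and the last 1 at even offset
-- c + 2s₁ before it.
record EvenRun (X : ℕ → Bool) (c : ℕ) : Set where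
  constructor evenRun
  field
    s₁ s₀      : ℕ
    s₁≤s₀      : s₁ ≤ s₀
    even-one   : X (c + 2 * s₁) ≡ true
    odd-one    : X (c + suc (2 * s₀)) ≡ true
    odd-zeros  : ∀ s → s < s₀ → X (c + suc (2 * s)) ≡ false
    even-zeros : ∀ s → s₁ < s → s ≤ s₀ → X (c + 2 * s) ≡ false

evenRun-from : ∀ X c → OddAhead X → X c ≡ true → EvenRun X c
evenRun-from X c ahead one-c with ahead c
... | s , one-s with least-true (λ s → X (c + suc (2 * s))) s one-s
...   | s₀ , _ , odd-one , odd-zeros
  with greatest-true (λ s → X (c + 2 * s)) s₀ (trans (cong X (ℕ.+-identityʳ c)) one-c)
...     | s₁ , s₁≤s₀ , even-one , even-zeros = evenRun s₁ s₀ s₁≤s₀ even-one odd-one odd-zeros even-zeros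

evenRun-gap : ∀ {X c} (run : EvenRun X c) → OddGap (shift (c + 2 * EvenRun.s₁ run) X)
evenRun-gap {X} {c} (evenRun s₁ s₀ s₁≤s₀ _ odd-one odd-zeros even-zeros) with ℕ.m≤n⇒∃[o]m+o≡n s₁≤s₀
... | D , refl = oddGap D (firstOne (s≤s z≤n) (trans (cong X (odd-shift c s₁ D)) odd-one) zeros)
  where
  odd-shift : ∀ c s t → c + 2 * s + suc (2 * t) ≡ c + suc (2 * (s + t))
  odd-shift = solve-∀
  even-shift : ∀ c s t → c + 2 * s + 2 * t ≡ c + 2 * (s + t)
  even-shift = solve-∀
  zeros : ∀ l → 1 ≤ l → l < suc (2 * D) → X (c + 2 * s₁ + l) ≡ false
  zeros l 1≤l l<1+2D with even-or-odd l
  ... | inj₁ (suc t , refl) = trans (cong X (even-shift c s₁ (suc t))) (even-zeros (s₁ + suc t)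
    (ℕ.m<m+n s₁ (s≤s z≤n)) (ℕ.+-monoʳ-≤ s₁ (ℕ.*-cancelˡ-≤ 2 (ℕ.≤-pred l<1+2D))))
  ... | inj₂ (t , refl) = trans (cong X (odd-shift c s₁ t)) (odd-zeros (s₁ + t)
    (ℕ.+-monoʳ-< s₁ (ℕ.*-cancelˡ-< 2 t D (ℕ.≤-pred l<1+2D))))

parity-+-2* : ∀ l k → parity (l + 2 * k) ≡ parity l
parity-+-2* l k =
  trans (ℙ.+-homo-+ l (2 * k)) (trans (cong (parity l +ℙ_) (parity-2* k)) (ℙ.+-identityʳ _))

parity-+-≢⇒odd : ∀ m n → parity (m + n) ≢ parity m → parity n ≡ 1ℙ
parity-+-≢⇒odd m n ≢ with parity n in pn
... | 1ℙ = refl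
... | 0ℙ = contradiction (trans (ℙ.+-homo-+ m n) (trans (cong (parity m +ℙ_) pn) (ℙ.+-identityʳ _))) ≢

record AnchorAfter (X : ℕ → Bool) (d : ℕ) : Set where
  constructor anchor
  field
    ρ        : ℕ
    d≤ρ      : d ≤ ρ
    parity-ρ : parity ρ ≡ parity d
    one      : X ρ ≡ true
    gap      : OddGap (shift ρ X)
    zeros    : ∀ l → 1 ≤ l → l < ρ → parity l ≢ parity d → X l ≡ false

anchorAfter : ∀ X {d} → OddAhead X → FirstOneAt X d → AnchorAfter X d
anchorAfter X {d} ahead (firstOne _ one-d zeros-d) with evenRun-from X d ahead one-d
... | run@(evenRun s₁ s₀ s₁≤s₀ even-one _ odd-zeros _) =
  anchor (d + 2 * s₁) (ℕ.m≤m+n d (2 * s₁)) (parity-+-2* d s₁) even-one (evenRun-gap run) zeros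
  where
  zeros : ∀ l → 1 ≤ l → l < d + 2 * s₁ → parity l ≢ parity d → X l ≡ false
  zeros l 1≤l l<ρ pl≢pd with ℕ.<-cmp l d
  ... | tri< l<d _ _ = zeros-d l 1≤l l<d
  ... | tri≈ _ refl _ = contradiction refl pl≢pd
  ... | tri> _ _ d<l with ℕ.m≤n⇒∃[o]m+o≡n (ℕ.<⇒≤ d<l)
  ...   | e , refl with odd-parity {e} (parity-+-≢⇒odd d e pl≢pd)
  ...     | s , refl = odd-zeros s (ℕ.<-≤-trans
    (ℕ.*-cancelˡ-< 2 s s₁ (ℕ.<-trans (ℕ.n<1+n _) (ℕ.+-cancelˡ-< d _ _ l<ρ))) s₁≤s₀)

anchor-ahead : ∀ X → OddAhead X → ∀ c → ∃ λ i → c ≤ i × X i ≡ true × OddGap (shift i X)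
anchor-ahead X ahead c with first-one (shift c X) (oddAhead-shift X c ahead)
... | d , first with anchorAfter (shift c X) (oddAhead-shift X c ahead) first
...   | anchor ρ _ _ one gap _ =
  c + ρ , ℕ.m≤m+n c ρ , one , oddGap-cong (λ l → cong X (sym (ℕ.+-assoc c ρ l))) gap

Mixed : (ℕ → Bool) → Set
Mixed Y = ∃ λ i → ∃ λ j → Y i ≡ true × Y j ≡ true × parity i ≢ parity j

parity-+-odd-≢ : ∀ m D → parity m ≢ parity (m + suc (2 * D))
parity-+-odd-≢ m D eq = p≢p+1 (parity m)
  (trans eq (trans (ℙ.+-homo-+ m (suc (2 * D))) (cong (parity m +ℙ_) (parity-suc-2* D))))
  where
  p≢p+1 : ∀ p → p ≢ p +ℙ 1ℙ
  p≢p+1 0ℙ ()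
  p≢p+1 1ℙ ()

SupportParity : Parity → (ℕ → Bool) → Set
SupportParity p X = ∀ i → X i ≡ true → parity i ≡ p

off-support : ∀ {p} X → SupportParity p X → ∀ i → parity i ≢ p → X i ≡ false
off-support X support i off with X i in Xi
... | true  = contradiction (support i Xi) off
... | false = refl

mixed-unsupported : ∀ {p} Y → Mixed Y → ¬ SupportParity p Y
mixed-unsupported Y (i , j , Yi , Yj , pi≢pj) support = pi≢pj (trans (support i Yi) (sym (support j Yj)))

-- The map f on sequences

module OnSequences (a : ℕ → Bool) (J : ℕ) where

  oddsClear : (ℕ → Bool) → ℕ → Bool
  oddsClear X zero    = true
  oddsClear X (suc j) = not (X (suc (2 * j))) ∧ oddsClear X j

  -- γ₀ k X and Γ X j are the coordinates 0 of γ_{2k}(X) and of Σ_{1 ≤ k ≤ j} aₖ γ_{2k}(X).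
  γ₀ : ℕ → (ℕ → Bool) → Bool
  γ₀ k X = X (2 * k) ∧ oddsClear X k

  Γ : (ℕ → Bool) → ℕ → Bool
  Γ X zero    = false
  Γ X (suc j) = Γ X j xor (a (suc j) ∧ γ₀ (suc j) X)

  F : (ℕ → Bool) → ℕ → Bool
  F X p = X p xor Γ (shift p X) J

  A : Poly
  A = true ∷ applyUpTo (λ i → a (suc i)) J

  Silent : (ℕ → Bool) → ℕ → Set
  Silent X E = ∀ k → E < k → γ₀ k X ≡ false

  oddsClear-killed : ∀ X {E k} → E < k → X (suc (2 * E)) ≡ true → oddsClear X k ≡ false
  oddsClear-killed X {E} {suc j} (s≤s E≤j) one with ℕ.m≤n⇒m<n∨m≡n E≤j
  ... | inj₁ E<j  = trans (cong (not (X (suc (2 * j))) ∧_) (oddsClear-killed X E<j one)) (∧-zeroʳ _)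
  ... | inj₂ refl = cong (λ b → not b ∧ oddsClear X j) one

  γ₀-local : ∀ X Y k → 1 ≤ k → (∀ l → 1 ≤ l → l ≤ 2 * k → X l ≡ Y l) → γ₀ k X ≡ γ₀ k Y
  γ₀-local X Y k 1≤k agree =
    cong₂ _∧_ (agree (2 * k) (ℕ.≤-trans 1≤k (ℕ.m≤n*m k 2)) ℕ.≤-refl) (odds k ℕ.≤-refl)
    where
    odds : ∀ j → j ≤ k → oddsClear X j ≡ oddsClear Y j
    odds zero    _     = refl
    odds (suc j) j<k = cong₂ (λ b c → not b ∧ c)
      (agree (suc (2 * j)) (s≤s z≤n)
        (ℕ.≤-trans (ℕ.n≤1+n _) (subst (_≤ 2 * k) (2*suc j) (ℕ.*-monoʳ-≤ 2 j<k))))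
      (odds j (ℕ.<⇒≤ j<k))

  Γ-agree : ∀ X Y j → (∀ k → 1 ≤ k → k ≤ j → γ₀ k X ≡ γ₀ k Y) → Γ X j ≡ Γ Y j
  Γ-agree X Y zero    agree = refl
  Γ-agree X Y (suc j) agree = cong₂ _xor_
    (Γ-agree X Y j λ k 1≤k k≤j → agree k 1≤k (ℕ.m≤n⇒m≤1+n k≤j))
    (cong (a (suc j) ∧_) (agree (suc j) (s≤s z≤n) ℕ.≤-refl))

  Γ-zero : ∀ X j → (∀ k → 1 ≤ k → k ≤ j → γ₀ k X ≡ false) → Γ X j ≡ false
  Γ-zero X zero    zero-terms = refl
  Γ-zero X (suc j) zero-terms = cong₂ _xor_
    (Γ-zero X j λ k 1≤k k≤j → zero-terms k 1≤k (ℕ.m≤n⇒m≤1+n k≤j))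
    (trans (cong (a (suc j) ∧_) (zero-terms (suc j) (s≤s z≤n) ℕ.≤-refl)) (∧-zeroʳ _))

  Γ-cong : ∀ X Y j → X ≗ Y → Γ X j ≡ Γ Y j
  Γ-cong X Y j X≗Y = Γ-agree X Y j λ k 1≤k _ → γ₀-local X Y k 1≤k λ l _ _ → X≗Y l

  F-cong : ∀ X Y → X ≗ Y → F X ≗ F Y
  F-cong X Y X≗Y p = cong₂ _xor_ (X≗Y p) (Γ-cong (shift p X) (shift p Y) J (X≗Y ∘ (p +_)))

  F-shift : ∀ X q → F (shift q X) ≗ shift q (F X)
  F-shift X q p = cong (X (q + p) xor_)
    (Γ-cong (shift p (shift q X)) (shift (q + p) X) J λ l → cong X (sym (ℕ.+-assoc q p l)))

  silent-odd : ∀ X E → X (suc (2 * E)) ≡ true → Silent X E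
  silent-odd X E one k E<k = trans (cong (X (2 * k) ∧_) (oddsClear-killed X E<k one)) (∧-zeroʳ _)

  Γ-local : ∀ X Y E j → Silent X E → Silent Y E →
            (∀ l → 1 ≤ l → l ≤ 2 * E → X l ≡ Y l) → Γ X j ≡ Γ Y j
  Γ-local X Y E j silent-X silent-Y agree = Γ-agree X Y j λ k 1≤k _ →
    [ (λ k≤E → γ₀-local X Y k 1≤k λ l 1≤l l≤2k → agree l 1≤l (ℕ.≤-trans l≤2k (ℕ.*-monoʳ-≤ 2 k≤E)))
    , (λ E<k → trans (silent-X k E<k) (sym (silent-Y k E<k))) ]′ (ℕ.≤-<-connex k E)

  Γ-vanish : ∀ X E j → Silent X E → (∀ k → 1 ≤ k → k ≤ E → X (2 * k) ≡ false) → Γ X j ≡ false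
  Γ-vanish X E j silent zero-evens = Γ-zero X j λ k 1≤k _ →
    [ (λ k≤E → cong (_∧ oddsClear X k) (zero-evens k 1≤k k≤E))
    , silent k ]′ (ℕ.≤-<-connex k E)

  silent-gap : ∀ X s → OddGap (shift (2 * s) X) → Silent X s
  silent-gap X s (oddGap D (firstOne _ one zeros)) k s<k with ℕ.m≤n⇒∃[o]m+o≡n s<k
  ... | t , refl with ℕ.<-≤-connex t D
  ...   | inj₁ t<D = cong (_∧ oddsClear X (suc s + t))
    (trans (cong X (2*-+-suc s t)) (zeros (2 * suc t) (s≤s z≤n) (s≤s (ℕ.*-monoʳ-≤ 2 t<D))))
  ...   | inj₂ D≤t = silent-odd X (s + D) (trans (cong X (suc-2*-+ s D)) one)
    (suc s + t) (s≤s (ℕ.+-monoʳ-≤ s D≤t))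

  F-at-gap : ∀ X p → OddGap (shift p X) → F X p ≡ X p
  F-at-gap X p gap = trans
    (cong (X p xor_) (Γ-vanish (shift p X) 0 J (silent-gap (shift p X) 0 gap) λ _ 1≤k k≤0 →
      contradiction (ℕ.≤-trans 1≤k k≤0) λ ()))
    (xor-identityʳ (X p))

  Γ-before-one : ∀ Y Y′ m j → Y m ≡ true → (∀ l → 1 ≤ l → l ≤ m → Y l ≡ Y′ l) →
                 OddGap (shift m Y) → OddGap (shift m Y′) → Γ Y j ≡ Γ Y′ j
  Γ-before-one Y Y′ m j one agree gap gap′ with even-or-odd m
  ... | inj₁ (s , refl) = Γ-local Y Y′ s j (silent-gap Y s gap) (silent-gap Y′ s gap′) agree
  ... | inj₂ (E , refl) = Γ-local Y Y′ E j
    (silent-odd Y E one) (silent-odd Y′ E (trans (sym (agree _ (s≤s z≤n) ℕ.≤-refl)) one))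
    λ l 1≤l l≤2E → agree l 1≤l (ℕ.m≤n⇒m≤1+n l≤2E)

  -- Walking backwards from a common 1 that starts an odd gap in both, x_q = f(x)_q − Γ
  -- and Γ is determined by the values already recovered.
  agree-before-anchor : ∀ X X′ i → F X ≗ F X′ → X i ≡ true →
                        OddGap (shift i X) → OddGap (shift i X′) → ∀ p → p ≤ i → X p ≡ X′ p
  agree-before-anchor X X′ i FX≗FX′ one gap gap′ p p≤i with ℕ.m≤n⇒∃[o]m+o≡n p≤i
  ... | m , p+m≡i = trans (cong X (sym (ℕ.+-identityʳ p)))
                          (trans (go m p p+m≡i 0 z≤n) (cong X′ (ℕ.+-identityʳ p)))
    where
    one′ : X′ i ≡ true
    one′ = trans (sym (F-at-gap X′ i gap′)) (trans (sym (FX≗FX′ i)) (trans (F-at-gap X i gap) one))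
    go : ∀ m q → q + m ≡ i → ∀ l → l ≤ m → X (q + l) ≡ X′ (q + l)
    go zero    q refl  zero z≤n = trans one (sym one′)
    go (suc m) q q+m≡i = λ
      { zero    _   → trans (cong X (ℕ.+-identityʳ q)) (trans here (cong X′ (sym (ℕ.+-identityʳ q))))
      ; (suc l) l≤m → after (suc l) (s≤s z≤n) l≤m }
      where
      gap-at : ∀ Z → OddGap (shift i Z) → OddGap (shift (suc m) (shift q Z))
      gap-at Z = oddGap-cong λ l → cong Z (trans (cong (_+ l) (sym q+m≡i)) (ℕ.+-assoc q (suc m) l))
      after : ∀ l → 1 ≤ l → l ≤ suc m → X (q + l) ≡ X′ (q + l)
      after (suc l) _ (s≤s l≤m) = trans (cong X (ℕ.+-suc q l))
        (trans (go m (suc q) (trans (sym (ℕ.+-suc q m)) q+m≡i) l l≤m) (cong X′ (sym (ℕ.+-suc q l))))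
      Γ-equal : Γ (shift q X) J ≡ Γ (shift q X′) J
      Γ-equal = Γ-before-one (shift q X) (shift q X′) (suc m) J (trans (cong X q+m≡i) one) after
                             (gap-at X gap) (gap-at X′ gap′)
      here : X q ≡ X′ q
      here = xor-cancelʳ (X q) (X′ q) (Γ (shift q X) J)
        (trans (FX≗FX′ q) (cong (X′ q xor_) (sym Γ-equal)))

  F-zeros-before-anchor : ∀ X {d} (an : AnchorAfter X d) →
    ∀ l → 1 ≤ l → l < AnchorAfter.ρ an → parity l ≢ parity d → F X l ≡ false
  F-zeros-before-anchor X (anchor ρ _ parity-ρ one _ zeros) l 1≤l l<ρ pl≢pd
    with ℕ.m≤n⇒∃[o]m+o≡n (ℕ.<⇒≤ l<ρ)
  ... | e , refl with odd-parity {e} (parity-+-≢⇒odd l e λ p → pl≢pd (trans (sym p) parity-ρ))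
  ...   | E , refl = cong₂ _xor_ (zeros l 1≤l l<ρ pl≢pd)
    (Γ-vanish (shift l X) E J (silent-odd (shift l X) E one) λ k 1≤k k≤E →
      zeros (l + 2 * k) (ℕ.≤-trans 1≤l (ℕ.m≤m+n l _)) (ℕ.+-monoʳ-< l (s≤s (ℕ.*-monoʳ-≤ 2 k≤E)))
            λ p → pl≢pd (trans (sym (parity-+-2* l k)) p))

  -- The anchor after the first 1 of x is a 1 of f(x), and f(x) vanishes before it
  -- at the other parity: so the first 1 of f(x) has the parity of the first 1 of x.
  first-one-parity : ∀ X {d} → OddAhead X → FirstOneAt X d →
                     ∃ λ d′ → FirstOneAt (F X) d′ × parity d′ ≡ parity d
  first-one-parity X {d} ahead first with anchorAfter X ahead first
  ... | an@(anchor ρ d≤ρ parity-ρ one gap _)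
    with first-one-upto (F X) (ℕ.≤-trans (FirstOneAt.positive first) d≤ρ) (trans (F-at-gap X ρ gap) one)
  ...   | d′ , d′≤ρ , first′ with parity d′ ℙ.≟ parity d
  ...     | yes same = d′ , first′ , same
  ...     | no  diff = contradiction
    (F-zeros-before-anchor X an d′ (FirstOneAt.positive first′) d′<ρ diff)
    (λ zero → contradiction (trans (sym (FirstOneAt.one first′)) zero) λ ())
    where
    d′<ρ : d′ < ρ
    d′<ρ = ℕ.≤∧≢⇒< d′≤ρ λ { refl → diff parity-ρ }

  oddGap-F : ∀ X → OddAhead X → OddGap X → OddGap (F X)
  oddGap-F X ahead (oddGap D first) with first-one-parity X ahead first
  ... | d′ , first′ , parity-d′ with odd-parity {d′} (trans parity-d′ (parity-suc-2* D))
  ...   | D′ , refl = oddGap D′ first′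

  oddGap-F⁻¹ : ∀ X → OddAhead X → OddGap (F X) → OddGap X
  oddGap-F⁻¹ X ahead (oddGap D′ firstF) with first-one X ahead
  ... | d , first with first-one-parity X ahead first
  ...   | d′ , first′ , parity-d′ with odd-parity {d}
    (trans (sym parity-d′) (trans (cong parity (firstOneAt-unique first′ firstF)) (parity-suc-2* D′)))
  ...     | D , refl = oddGap D first

  oddGap-F-at : ∀ X i → OddAhead X → OddGap (shift i X) → OddGap (shift i (F X))
  oddGap-F-at X i ahead gap =
    oddGap-cong (F-shift X i) (oddGap-F (shift i X) (oddAhead-shift X i ahead) gap)

  oddGap-F⁻¹-at : ∀ X i → OddAhead X → OddGap (shift i (F X)) → OddGap (shift i X)
  oddGap-F⁻¹-at X i ahead gap =
    oddGap-F⁻¹ (shift i X) (oddAhead-shift X i ahead) (oddGap-cong (sym ∘ F-shift X i) gap)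

  F-injective-oddAhead : ∀ X X′ → OddAhead X → OddAhead X′ → F X ≗ F X′ → X ≗ X′
  F-injective-oddAhead X X′ ahead ahead′ FX≗FX′ p = go (anchor-ahead X ahead p)
    where
    go : (∃ λ i → p ≤ i × X i ≡ true × OddGap (shift i X)) → X p ≡ X′ p
    go (i , p≤i , one , gap) = agree-before-anchor X X′ i FX≗FX′ one gap gap′ p p≤i
      where
      gapF : OddGap (shift i (F X))
      gapF = oddGap-F-at X i ahead gap
      gapF′ : OddGap (shift i (F X′))
      gapF′ = oddGap-cong {shift i (F X)} {shift i (F X′)} (λ l → FX≗FX′ (i + l)) gapF
      gap′ : OddGap (shift i X′)
      gap′ = oddGap-F⁻¹-at X′ i ahead′ gapF′

  F-mixed : ∀ X → OddAhead X → Mixed (F X)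
  F-mixed X ahead = go (anchor-ahead X ahead 0)
    where
    mixed : ∀ i → F X i ≡ true → OddGap (shift i (F X)) → Mixed (F X)
    mixed i one (oddGap D (firstOne _ one′ _)) = i , i + suc (2 * D) , one , one′ , parity-+-odd-≢ i D
    go : (∃ λ i → 0 ≤ i × X i ≡ true × OddGap (shift i X)) → Mixed (F X)
    go (i , _ , one , gap) = mixed i (trans (F-at-gap X i gap) one) (oddGap-F-at X i ahead gap)

  supportParity-F : ∀ {p} X → SupportParity p X → SupportParity p (F X)
  supportParity-F {p} X support i FXi with parity i ℙ.≟ p
  ... | yes pi≡p = pi≡p
  ... | no  pi≢p = contradiction (trans (sym FXi) FXi≡false) λ ()
    where
    FXi≡false : F X i ≡ false
    FXi≡false = cong₂ _xor_ (off-support X support i pi≢p) (Γ-zero (shift i X) J λ k _ _ →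
      cong (_∧ oddsClear (shift i X) k)
           (off-support X support (i + 2 * k) λ e → pi≢p (trans (sym (parity-+-2* i k)) e)))

  F-false : F (λ _ → false) ≗ (λ _ → false)
  F-false p = Γ-zero (λ _ → false) J λ _ _ _ → refl

  oddsClear-true : ∀ X → (∀ j → X (suc (2 * j)) ≡ false) → ∀ k → oddsClear X k ≡ true
  oddsClear-true X odd-zeros zero    = refl
  oddsClear-true X odd-zeros (suc k) =
    cong₂ (λ b c → not b ∧ c) (odd-zeros k) (oddsClear-true X odd-zeros k)

  Γ-clear : ∀ X j → (∀ k → oddsClear X k ≡ true) →
            Γ X j ≡ ⟨ applyUpTo (λ i → a (suc i)) j , (λ i → X (2 * suc i)) ⟩
  Γ-clear X zero    clear = refl
  Γ-clear X (suc j) clear = begin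
    Γ X j xor (a (suc j) ∧ (X (2 * suc j) ∧ oddsClear X (suc j)))
      ≡⟨ cong₂ (λ g c → g xor (a (suc j) ∧ (X (2 * suc j) ∧ c))) (Γ-clear X j clear) (clear (suc j)) ⟩
    ⟨ applyUpTo (λ i → a (suc i)) j , w ⟩ xor (a (suc j) ∧ (X (2 * suc j) ∧ true))
      ≡⟨ cong (λ c → ⟨ applyUpTo (λ i → a (suc i)) j , w ⟩ xor (a (suc j) ∧ c)) (∧-identityʳ _) ⟩
    ⟨ applyUpTo (λ i → a (suc i)) j , w ⟩ xor (a (suc j) ∧ w j)
      ≡⟨ ⟨⟩-applyUpTo-suc (λ i → a (suc i)) j w ⟨
    ⟨ applyUpTo (λ i → a (suc i)) (suc j) , w ⟩ ∎
    where
    open ≡-Reasoning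
    w = λ i → X (2 * suc i)

  F-even-support : ∀ X → SupportParity 0ℙ X → ∀ r → F X (2 * r) ≡ (A ⋆ (λ i → X (2 * i))) r
  F-even-support X support r = cong₂ _xor_ (cong X (cong (2 *_) (sym (ℕ.+-identityʳ r))))
    (trans (Γ-clear (shift (2 * r) X) J (oddsClear-true (shift (2 * r) X) odd-zeros))
           (⟨⟩-cong (applyUpTo (λ i → a (suc i)) J) λ i → cong X (sym (ℕ.*-distribˡ-+ 2 r (suc i)))))
    where
    odd-zeros : ∀ j → X (2 * r + suc (2 * j)) ≡ false
    odd-zeros j = off-support X support (2 * r + suc (2 * j)) λ e → contradiction (trans (sym e)
      (trans (ℙ.+-homo-+ (2 * r) (suc (2 * j))) (cong₂ _+ℙ_ (parity-2* r) (parity-suc-2* j)))) λ ()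

-- f on sequences of period n = 2h

spread : (ℕ → Bool) → ℕ → Bool
spread u zero          = u 0
spread u (suc zero)    = false
spread u (suc (suc i)) = spread (u ∘ suc) i

spread-2* : ∀ u r → spread u (2 * r) ≡ u r
spread-2* u zero    = refl
spread-2* u (suc r) = trans (cong (spread u) (2*suc r)) (spread-2* (u ∘ suc) r)

spread-odd : ∀ u r → spread u (suc (2 * r)) ≡ false
spread-odd u zero    = refl
spread-odd u (suc r) = trans (cong (spread u ∘ suc) (2*suc r)) (spread-odd (u ∘ suc) r)

spread-periodic : ∀ h u → Periodic h u → Periodic (h + h) (spread u)
spread-periodic h u per i with even-or-odd i
... | inj₁ (s , refl) = trans (cong (spread u) (sym (2*[h+r] h s)))
  (trans (spread-2* u (h + s)) (trans (per s) (sym (spread-2* u s))))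
... | inj₂ (s , refl) =
  trans (cong (spread u) (trans (ℕ.+-suc (h + h) (2 * s)) (cong suc (sym (2*[h+r] h s)))))
  (trans (spread-odd u (h + s)) (sym (spread-odd u s)))

spread-supported : ∀ u → SupportParity 0ℙ (spread u)
spread-supported u i ui with even-or-odd i
... | inj₁ (s , refl) = parity-2* s
... | inj₂ (s , refl) = contradiction (trans (sym ui) (spread-odd u s)) λ ()

InjectiveOnPeriodic : ℕ → ((ℕ → Bool) → ℕ → Bool) → Set
InjectiveOnPeriodic n G = ∀ X X′ → Periodic n X → Periodic n X′ → G X ≗ G X′ → X ≗ X′


module OnPeriodicSequences (a : ℕ → Bool) (J h′ : ℕ) where
  open OnSequences a J

  h n : ℕ
  h = suc h′
  n = h + h


  parity-+*n : ∀ r k → parity (r + k * n) ≡ parity r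
  parity-+*n r k = begin
    parity (r + k * n)                           ≡⟨ ℙ.+-homo-+ r (k * n) ⟩
    parity r +ℙ parity (k * n)                   ≡⟨ cong (parity r +ℙ_) (ℙ.*-homo-* k n) ⟩
    parity r +ℙ (parity k ℙ* parity n)           ≡⟨ cong (λ q → parity r +ℙ (parity k ℙ* q)) parity-n ⟩
    parity r +ℙ (parity k ℙ* 0ℙ)                 ≡⟨ cong (parity r +ℙ_) (ℙ.*-zeroʳ (parity k)) ⟩
    parity r +ℙ 0ℙ                               ≡⟨ ℙ.+-identityʳ (parity r) ⟩
    parity r                                     ∎
    where
    open ≡-Reasoning
    parity-n : parity n ≡ 0ℙ
    parity-n = trans (ℙ.+-homo-+ h h) (ℙ.p+p≡0ℙ (parity h))

  one-below-n : ∀ X → Periodic n X → ∀ {p} i → X i ≡ true → parity i ≡ p →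
                ∃ λ r → r < n × (X r ≡ true × parity r ≡ p)
  one-below-n X per i Xi pi = i % n , m%n<n i n , trans (periodic-% n X per i) Xi ,
    trans (sym (parity-+*n (i % n) (i / n))) (trans (cong parity (sym (m≡m%n+[m/n]*n i n))) pi)

  ones-of? : ∀ (X : ℕ → Bool) p r → Dec (X r ≡ true × parity r ≡ p)
  ones-of? X p r = (X r Boolₚ.≟ true) ×-dec (parity r ℙ.≟ p)

  supported-if-no-ones : ∀ X → Periodic n X → ∀ p →
    ¬ (∃ λ r → r < n × (X r ≡ true × parity r ≡ p)) → SupportParity (p ⁻¹) X
  supported-if-no-ones X per p none i Xi with parity i ℙ.≟ p
  ... | yes pi = contradiction (one-below-n X per i Xi pi) none
  ... | no  pi≢p = ≢⇒⁻¹ pi≢p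
    where
    ≢⇒⁻¹ : ∀ {q r} → q ≢ r → q ≡ r ⁻¹
    ≢⇒⁻¹ {0ℙ} {0ℙ} q≢r = contradiction refl q≢r
    ≢⇒⁻¹ {0ℙ} {1ℙ} _   = refl
    ≢⇒⁻¹ {1ℙ} {0ℙ} _   = refl
    ≢⇒⁻¹ {1ℙ} {1ℙ} q≢r = contradiction refl q≢r

  classify : ∀ X → Periodic n X → (∃ λ p → SupportParity p X) ⊎ Mixed X
  classify X per with ℕ.anyUpTo? (ones-of? X 0ℙ) n | ℕ.anyUpTo? (ones-of? X 1ℙ) n
  ... | yes (i , _ , Xi , pi) | yes (j , _ , Xj , pj) =
    inj₂ (i , j , Xi , Xj , λ eq → contradiction (trans (sym pi) (trans eq pj)) λ ())
  ... | _       | no none = inj₁ (0ℙ , supported-if-no-ones X per 1ℙ none)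
  ... | no none | yes _   = inj₁ (1ℙ , supported-if-no-ones X per 0ℙ none)

  periodic-shift : ∀ X p → Periodic n X → Periodic n (shift p X)
  periodic-shift X p per r = trans (cong X (+-swap p n r)) (per (p + r))
    where
    +-swap : ∀ p n r → p + (n + r) ≡ n + (p + r)
    +-swap = solve-∀

  one-at-odd-offset : ∀ X → Periodic n X → ∀ y c → X y ≡ true → parity y ≢ parity c →
                      ∃ λ s → X (c + suc (2 * s)) ≡ true
  one-at-odd-offset X per y c Xy py≢pc with ℕ.m≤n⇒∃[o]m+o≡n c<y+[1+c]n
    where
    c<y+[1+c]n : c < y + suc c * n
    c<y+[1+c]n = ℕ.≤-trans (ℕ.m≤m*n (suc c) n) (ℕ.m≤n+m (suc c * n) y)
  ... | o , 1+c+o≡y+[1+c]n with odd-parity {suc o} (parity-+-≢⇒odd c (suc o) λ eq →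
        py≢pc (trans (sym (parity-+*n y (suc c))) (trans (cong parity (sym c+1+o≡)) eq)))
    where
    c+1+o≡ : c + suc o ≡ y + suc c * n
    c+1+o≡ = trans (ℕ.+-suc c o) 1+c+o≡y+[1+c]n
  ...   | s , refl = s , (begin
    X (c + suc (2 * s))      ≡⟨ cong X (trans (ℕ.+-suc c (2 * s)) 1+c+o≡y+[1+c]n) ⟩
    X (y + suc c * n)        ≡⟨ cong X (ℕ.+-comm y (suc c * n)) ⟩
    X (suc c * n + y)        ≡⟨ periodic-+* X per (suc c) y ⟩
    X y                      ≡⟨ Xy ⟩
    true                     ∎)
    where open ≡-Reasoning

  mixed⇒oddAhead : ∀ X → Periodic n X → Mixed X → OddAhead X
  mixed⇒oddAhead X per (i , j , Xi , Xj , pi≢pj) c with parity i ℙ.≟ parity c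
  ... | yes pi≡pc = one-at-odd-offset X per j c Xj λ pj≡pc → pi≢pj (trans pi≡pc (sym pj≡pc))
  ... | no  pi≢pc = one-at-odd-offset X per i c Xi pi≢pc

  even-supported-injective : KernelTrivial A h → ∀ X X′ → Periodic n X → Periodic n X′ →
    SupportParity 0ℙ X → SupportParity 0ℙ X′ → F X ≗ F X′ → X ≗ X′
  even-supported-injective kernel X X′ per per′ support support′ FX≗FX′ i with even-or-odd i
  ... | inj₁ (r , refl) = xor-cancelʳ (X (2 * r)) (X′ (2 * r)) (X′ (2 * r))
                            (trans (kernel u per-u A⋆u≡0 r) (sym (xor-same (X′ (2 * r)))))
    where
    evens evens′ u : ℕ → Bool
    evens  r = X (2 * r)
    evens′ r = X′ (2 * r)
    u      r = evens r xor evens′ r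
    per-u : Periodic h u
    per-u r = cong₂ _xor_ (trans (cong X (2*[h+r] h r)) (per (2 * r)))
                          (trans (cong X′ (2*[h+r] h r)) (per′ (2 * r)))
    A⋆u≡0 : ∀ r → (A ⋆ u) r ≡ false
    A⋆u≡0 r = begin
      (A ⋆ u) r                          ≡⟨ ⟨⟩-xor A (shift r evens) (shift r evens′) ⟩
      (A ⋆ evens) r xor (A ⋆ evens′) r   ≡⟨ cong₂ _xor_ (F-even-support X support r)
                                                        (F-even-support X′ support′ r) ⟨
      F X (2 * r) xor F X′ (2 * r)       ≡⟨ cong (_xor F X′ (2 * r)) (FX≗FX′ (2 * r)) ⟩
      F X′ (2 * r) xor F X′ (2 * r)      ≡⟨ xor-same (F X′ (2 * r)) ⟩
      false                              ∎
      where open ≡-Reasoning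
  ... | inj₂ (r , refl) = trans (off-support X support _ odd) (sym (off-support X′ support′ _ odd))
    where
    odd : parity (suc (2 * r)) ≢ 0ℙ
    odd e = contradiction (trans (sym (parity-suc-2* r)) e) λ ()

  supported-injective : KernelTrivial A h → ∀ p X X′ → Periodic n X → Periodic n X′ →
    SupportParity p X → SupportParity p X′ → F X ≗ F X′ → X ≗ X′
  supported-injective kernel 0ℙ = even-supported-injective kernel
  supported-injective kernel 1ℙ X X′ per per′ support support′ FX≗FX′ = X≗X′
    where
    shifted-support : ∀ Y → SupportParity 1ℙ Y → SupportParity 0ℙ (shift 1 Y)
    shifted-support Y supp i Yi = trans (sym (ℙ.suc-homo-⁻¹ i)) (cong _⁻¹ (supp (suc i) Yi))
    shifted : shift 1 X ≗ shift 1 X′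
    shifted = even-supported-injective kernel (shift 1 X) (shift 1 X′)
      (periodic-shift X 1 per) (periodic-shift X′ 1 per′)
      (shifted-support X support) (shifted-support X′ support′)
      λ p → trans (F-shift X 1 p) (trans (FX≗FX′ (suc p)) (sym (F-shift X′ 1 p)))
    X≗X′ : X ≗ X′
    X≗X′ zero    = trans (sym (per 0)) (trans (shifted (n ∸ 1 + 0)) (per′ 0))
    X≗X′ (suc i) = shifted i

  -- Sequences supported on one parity class are handled by the kernel of A ⋆ _, those with
  -- ones of both parities by decoding from anchors; f never mixes the two kinds.
  kernelTrivial⇒injective : KernelTrivial A h → InjectiveOnPeriodic n F
  kernelTrivial⇒injective kernel X X′ per per′ FX≗FX′ = go (classify X per) (classify X′ per′)
    where
    F-vanishes : ∀ {p q} → p ≢ q → SupportParity p X → SupportParity q X′ → ∀ i → F X i ≡ false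
    F-vanishes p≢q support support′ i with F X i in FXi
    ... | false = refl
    ... | true  = contradiction (trans (sym (supportParity-F X support i FXi))
                                       (supportParity-F X′ support′ i (trans (sym (FX≗FX′ i)) FXi))) p≢q
    unmixed : ∀ {p} Y Y′ → F Y ≗ F Y′ → Periodic n Y′ → SupportParity p Y → ¬ Mixed Y′
    unmixed Y Y′ FY≗FY′ per-Y′ support mixed′ = mixed-unsupported (F Y′)
      (F-mixed Y′ (mixed⇒oddAhead Y′ per-Y′ mixed′))
      λ i e → supportParity-F Y support i (trans (FY≗FY′ i) e)
    go : (∃ λ p → SupportParity p X) ⊎ Mixed X → (∃ λ p → SupportParity p X′) ⊎ Mixed X′ → X ≗ X′
    go (inj₁ (p , support)) (inj₁ (q , support′)) with p ℙ.≟ q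
    ... | yes refl = supported-injective kernel p X X′ per per′ support support′ FX≗FX′
    ... | no  p≢q  = λ i → trans (X≗0 i) (sym (X′≗0 i))
      where
      X≗0 : X ≗ (λ _ → false)
      X≗0 = supported-injective kernel p X (λ _ → false) per (λ _ → refl) support (λ _ ())
              λ i → trans (F-vanishes p≢q support support′ i) (sym (F-false i))
      X′≗0 : X′ ≗ (λ _ → false)
      X′≗0 = supported-injective kernel q X′ (λ _ → false) per′ (λ _ → refl) support′ (λ _ ())
               λ i → trans (sym (FX≗FX′ i)) (trans (F-vanishes p≢q support support′ i) (sym (F-false i)))
    go (inj₁ (_ , support)) (inj₂ mixed′) = contradiction mixed′ (unmixed X X′ FX≗FX′ per′ support)
    go (inj₂ mixed) (inj₁ (_ , support′)) =
      contradiction mixed (unmixed X′ X (sym ∘ FX≗FX′) per support′)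
    go (inj₂ mixed) (inj₂ mixed′) =
      F-injective-oddAhead X X′ (mixed⇒oddAhead X per mixed) (mixed⇒oddAhead X′ per′ mixed′) FX≗FX′

  -- A kernel element u of A ⋆ _, spread onto the even positions, has the same image as 0.
  injective⇒kernelTrivial : InjectiveOnPeriodic n F → KernelTrivial A h
  injective⇒kernelTrivial injective u per A⋆u≡0 r =
    trans (sym (spread-2* u r))
          (injective (spread u) (λ _ → false) (spread-periodic h u per) (λ _ → refl) F≗F0 (2 * r))
    where
    F≗F0 : F (spread u) ≗ F (λ _ → false)
    F≗F0 i = trans (vanishes i) (sym (F-false i))
      where
      vanishes : ∀ i → F (spread u) i ≡ false
      vanishes i with even-or-odd i
      ... | inj₁ (s , refl) = trans (F-even-support (spread u) (spread-supported u) s)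
                                    (trans (⋆-cong A (spread-2* u) s) (A⋆u≡0 s))
      ... | inj₂ (s , refl) =
        off-support (F (spread u)) (supportParity-F (spread u) (spread-supported u)) (suc (2 * s))
          λ e → contradiction (trans (sym (parity-suc-2* s)) e) λ ()

fin-injective⇒surjective : ∀ {N} (f : Fin N → Fin N) → Injective _≡_ _≡_ f → Surjective _≡_ _≡_ f
fin-injective⇒surjective {suc N} f injective y with any? (λ x → f x Finₚ.≟ y)
... | yes (x , fx≡y) = x , λ { refl → fx≡y }
... | no  missed     = contradiction (injective⇒≤ punchOut∘f-injective) ℕ.1+n≰n
  where
  y≢f : ∀ x → y ≢ f x
  y≢f x y≡fx = missed (x , sym y≡fx)
  punchOut∘f-injective : Injective _≡_ _≡_ (λ x → punchOut (y≢f x))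
  punchOut∘f-injective {x} {x′} eq = injective (punchOut-injective (y≢f x) (y≢f x′) eq)

↔Fin-injective⇒surjective : ∀ {A : Set} {N} → A ↔ Fin N →
                            (f : A → A) → Injective _≡_ _≡_ f → Surjective _≡_ _≡_ f
↔Fin-injective⇒surjective {A} A↔Fin f injective y
  with fin-injective⇒surjective (to ∘ f ∘ from) to∘f∘from-injective (to y)
  where
  open Inverse A↔Fin
  to∘f∘from-injective : Injective _≡_ _≡_ (to ∘ f ∘ from)
  to∘f∘from-injective {i} {j} eq = begin
    i                 ≡⟨ strictlyInverseˡ i ⟨
    to (from i)       ≡⟨ cong to (injective (trans (sym (strictlyInverseʳ _))
                                                       (trans (cong from eq) (strictlyInverseʳ _)))) ⟩
    to (from j)       ≡⟨ strictlyInverseˡ j ⟩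
    j                 ∎
    where open ≡-Reasoning
... | i , hit = from i , λ
  { refl → trans (sym (strictlyInverseʳ _)) (trans (cong from (hit refl)) (strictlyInverseʳ y)) }
  where open Inverse A↔Fin

Vec-Bool↔Fin : ∀ n → Vec Bool n ↔ Fin (2 ^ n)
Vec-Bool↔Fin zero    =
  mk↔ₛ′ (λ _ → Fin.zero) (λ _ → []) (λ { Fin.zero → refl ; (Fin.suc ()) }) (λ { [] → refl })
Vec-Bool↔Fin (suc n) = ↔-trans uncons (↔-trans (↔-sym 2↔Bool ×-↔ Vec-Bool↔Fin n) (↔-sym *↔×))
  where
  uncons : Vec Bool (suc n) ↔ (Bool × Vec Bool n)
  uncons = mk↔ₛ′ (λ { (b ∷ bs) → b , bs }) (λ (b , bs) → b ∷ bs) (λ _ → refl) (λ { (b ∷ bs) → refl })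

injective⇒bijective : ∀ {n} (f : Vec Bool n → Vec Bool n) → Injective _≡_ _≡_ f → Bijective _≡_ _≡_ f
injective⇒bijective {n} f injective = injective , ↔Fin-injective⇒surjective (Vec-Bool↔Fin n) f injective

-- Vectors as periodic sequences

lookup-∷ʳ-< : ∀ {A : Set} {m} (ys : Vec A m) y {j} (j<m : j < m) .(j<1+m : j < suc m) →
              lookup (ys ∷ʳ y) (fromℕ< j<1+m) ≡ lookup ys (fromℕ< j<m)
lookup-∷ʳ-< (z ∷ zs) y {zero}  _         _     = refl
lookup-∷ʳ-< (z ∷ zs) y {suc j} (s≤s j<m) j<1+m = lookup-∷ʳ-< zs y j<m (ℕ.≤-pred j<1+m)

lookup-∷ʳ-last : ∀ {A : Set} {m} (ys : Vec A m) y .(m<1+m : m < suc m) →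
                 lookup (ys ∷ʳ y) (fromℕ< m<1+m) ≡ y
lookup-∷ʳ-last []       y _     = refl
lookup-∷ʳ-last (z ∷ zs) y m<1+m = lookup-∷ʳ-last zs y (ℕ.≤-pred m<1+m)

module OnVectors (a : ℕ → Bool) (N : ℕ) where
  open OnSequences a N

  n : ℕ
  n = suc N

  ev : Vec Bool n → ℕ → Bool
  ev x p = lookup x (p mod n)

  ev-cong : ∀ x {p q} → p % n ≡ q % n → ev x p ≡ ev x q
  ev-cong x {p} {q} eq = cong (lookup x) (fromℕ<-cong (p % n) (q % n) eq _ _)

  ev-periodic : ∀ x → Periodic n (ev x)
  ev-periodic x r = ev-cong x {n + r} {r} (trans (cong (_% n) (ℕ.+-comm n r)) ([m+n]%n≡m%n r n))

  ev-toℕ : ∀ x i → ev x (toℕ i) ≡ lookup x i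
  ev-toℕ x i =
    cong (lookup x) (trans (fromℕ<-cong _ _ (m<n⇒m%n≡m (toℕ<n i)) _ (toℕ<n i)) (fromℕ<-toℕ i _))

  ev-injective : ∀ x y → ev x ≗ ev y → x ≡ y
  ev-injective x y ev≗ = begin
    x                   ≡⟨ tabulate∘lookup x ⟨
    tabulate (lookup x) ≡⟨ tabulate-cong lookup≗ ⟩
    tabulate (lookup y) ≡⟨ tabulate∘lookup y ⟩
    y                   ∎
    where
    open ≡-Reasoning
    lookup≗ : lookup x ≗ lookup y
    lookup≗ i = trans (sym (ev-toℕ x i)) (trans (ev≗ (toℕ i)) (ev-toℕ y i))

  ev-tabulate : ∀ X → Periodic n X → ev (tabulate (X ∘ toℕ)) ≗ X
  ev-tabulate X per p = trans (lookup∘tabulate (X ∘ toℕ) (p mod n))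
    (trans (cong X (toℕ-fromℕ< (m%n<n p n))) (periodic-% n X per p))

  ev-zipWith : ∀ (f : Bool → Bool → Bool) x y p → ev (zipWith f x y) p ≡ f (ev x p) (ev y p)
  ev-zipWith f x y p = lookup-zipWith f (p mod n) x y

  ev-replicate : ∀ b p → ev (replicate n b) p ≡ b
  ev-replicate b p = lookup-replicate (p mod n) b

  suc-% : ∀ p → suc (p % n) % n ≡ suc p % n
  suc-% p = trans (%-distribˡ-+ 1 (p % n) n)
    (trans (cong (λ r → (1 % n + r) % n) (m%n%n≡m%n p n)) (sym (%-distribˡ-+ 1 p n)))

  ev-S : ∀ x p → ev (S x) p ≡ ev x (suc p)
  ev-S (y ∷ ys) p with ℕ.m≤n⇒m<n∨m≡n (ℕ.≤-pred (m%n<n p n))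
  ... | inj₁ p%n<N = trans (lookup-∷ʳ-< ys y p%n<N (m%n<n p n))
    (cong (lookup (y ∷ ys)) (fromℕ<-cong _ _ 1+p%n≡[1+p]%n (s≤s p%n<N) _))
    where
    1+p%n≡[1+p]%n : suc (p % n) ≡ suc p % n
    1+p%n≡[1+p]%n = trans (sym (m<n⇒m%n≡m (s≤s p%n<N))) (suc-% p)
  ... | inj₂ p%n≡N = trans (cong (lookup (ys ∷ʳ y)) (fromℕ<-cong _ _ p%n≡N _ (ℕ.n<1+n N)))
    (trans (lookup-∷ʳ-last ys y _) (cong (lookup (y ∷ ys)) (fromℕ<-cong 0 _ 0≡[1+p]%n (s≤s z≤n) _)))
    where
    0≡[1+p]%n : 0 ≡ suc p % n
    0≡[1+p]%n = trans (sym (n%n≡0 n)) (trans (cong (λ j → suc j % n) (sym p%n≡N)) (suc-% p))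

  ev-S^ : ∀ k x p → ev (S^ k x) p ≡ ev x (p + k)
  ev-S^ zero    x p = cong (ev x) (sym (ℕ.+-identityʳ p))
  ev-S^ (suc k) x p =
    trans (ev-S (S^ k x) p) (trans (ev-S^ k x (suc p)) (cong (ev x) (sym (ℕ.+-suc p k))))

  ev-oddProd : ∀ k x p → ev (oddProd k x) p ≡ oddsClear (shift p (ev x)) k
  ev-oddProd zero    x p = ev-replicate true p
  ev-oddProd (suc j) x p = trans (ev-zipWith _∧_ (𝟙 ⊕ S^ (suc (2 * j)) x) (oddProd j x) p)
    (cong₂ _∧_ (trans (ev-zipWith _xor_ 𝟙 (S^ (suc (2 * j)) x) p)
                      (cong₂ _xor_ (ev-replicate true p) (ev-S^ (suc (2 * j)) x p)))
               (ev-oddProd j x p))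

  ev-γ : ∀ k x p → ev (γ (suc k) x) p ≡ γ₀ (suc k) (shift p (ev x))
  ev-γ k x p = trans (ev-zipWith _∧_ (S^ (2 * suc k) x) (oddProd (suc k) x) p)
    (cong₂ _∧_ (ev-S^ (2 * suc k) x p) (ev-oddProd (suc k) x p))

  ev-γsum : ∀ j x p → ev (γsum a j x) p ≡ Γ (shift p (ev x)) j
  ev-γsum zero    x p = ev-replicate false p
  ev-γsum (suc j) x p = trans (ev-zipWith _xor_ (γsum a j x) (if a (suc j) then γ (suc j) x else 𝟘) p)
    (cong₂ _xor_ (ev-γsum j x p) (summand (a (suc j))))
    where
    summand : ∀ b → ev (if b then γ (suc j) x else 𝟘) p ≡ b ∧ γ₀ (suc j) (shift p (ev x))
    summand true  = ev-γ j x p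
    summand false = ev-replicate false p

  ev-fMap : ∀ x → ev (fMap n a x) ≗ F (ev x)
  ev-fMap x p = trans (ev-zipWith _xor_ x (γsum a N x) p) (cong (ev x p xor_) (ev-γsum N x p))

  injectiveOnPeriodic⇒injective : InjectiveOnPeriodic n F → Injective _≡_ _≡_ (fMap n a)
  injectiveOnPeriodic⇒injective injective {x} {y} fx≡fy =
    ev-injective x y (injective (ev x) (ev y) (ev-periodic x) (ev-periodic y) λ p →
      trans (sym (ev-fMap x p)) (trans (cong (λ z → ev z p) fx≡fy) (ev-fMap y p)))

  injective⇒injectiveOnPeriodic : Injective _≡_ _≡_ (fMap n a) → InjectiveOnPeriodic n F
  injective⇒injectiveOnPeriodic injective X X′ per per′ FX≗FX′ p = begin
    X p       ≡⟨ ev-tabulate X per p ⟨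
    ev x p    ≡⟨ cong (λ z → ev z p) (injective {x} {x′} (ev-injective (fMap n a x) (fMap n a x′) fx≗fx′)) ⟩
    ev x′ p   ≡⟨ ev-tabulate X′ per′ p ⟩
    X′ p      ∎
    where
    open ≡-Reasoning
    x x′ : Vec Bool n
    x  = tabulate (X ∘ toℕ)
    x′ = tabulate (X′ ∘ toℕ)
    ev-fMap-tabulate : ∀ Y → Periodic n Y → ev (fMap n a (tabulate (Y ∘ toℕ))) ≗ F Y
    ev-fMap-tabulate Y per-Y q = trans (ev-fMap y q) (F-cong (ev y) Y (ev-tabulate Y per-Y) q)
      where y = tabulate (Y ∘ toℕ)
    fx≗fx′ : ev (fMap n a x) ≗ ev (fMap n a x′)
    fx≗fx′ q = trans (ev-fMap-tabulate X per q) (trans (FX≗FX′ q) (sym (ev-fMap-tabulate X′ per′ q)))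

  injective⇔injectiveOnPeriodic : Injective _≡_ _≡_ (fMap n a) ⇔ InjectiveOnPeriodic n F
  injective⇔injectiveOnPeriodic = mk⇔ injective⇒injectiveOnPeriodic injectiveOnPeriodic⇒injective

module Criterion (a : ℕ → Bool) (N h′ : ℕ) (n≡h+h : suc N ≡ suc h′ + suc h′) where
  open OnSequences a N using (F)
  open OnVectors a N using (injective⇔injectiveOnPeriodic)
  open OnPeriodicSequences a N h′ using (kernelTrivial⇒injective; injective⇒kernelTrivial)

  n h : ℕ
  n = suc N
  h = suc h′

  injective⇔kernelTrivial : Injective _≡_ _≡_ (fMap n a) ⇔ KernelTrivial (aPoly n a) h
  injective⇔kernelTrivial = ⇔-trans injective⇔injectiveOnPeriodic
    (mk⇔ (injective⇒kernelTrivial ∘ subst InjectiveOnPeriod n≡h+h)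
         (subst InjectiveOnPeriod (sym n≡h+h) ∘ kernelTrivial⇒injective))
    where
    InjectiveOnPeriod : ℕ → Set
    InjectiveOnPeriod m = InjectiveOnPeriodic m F

  bijective⇔coprime : Bijective _≡_ _≡_ (fMap n a) ⇔ Coprime (aPoly n a) (oneₚ +ₚ X^ h)
  bijective⇔coprime = mk⇔
    (λ bijective → gcdOne⇒coprime (kernelTrivial⇒gcdOne (aPoly n a) h′
      (Equivalence.to injective⇔kernelTrivial (λ {x} {y} → proj₁ bijective {x} {y}))))
    (λ coprime → injective⇒bijective (fMap n a)
      (Equivalence.from injective⇔kernelTrivial (coprime⇒kernelTrivial coprime)))

  coprime⇔isUnitMod : Coprime (aPoly n a) (oneₚ +ₚ X^ h) ⇔ IsUnitMod (X^ n +ₚ X^ h) (aPoly n a)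
  coprime⇔isUnitMod = ⇔-trans
    (mk⇔ (λ coprime → coprime-∣ʳ (coprime-*ʳ (coprime-X^ _ h) coprime)
                                 (oneₚ , ≋-trans (*ₚ-identityˡ M) M≋X^h*B))
         (λ coprime → coprime-∣ʳ coprime (X^ h , ≋-sym M≋X^h*B)))
    (⇔-sym (isUnitMod⇔coprime M (aPoly n a)))
    where
    M = X^ n +ₚ X^ h
    M≋X^h*B : M ≋ (X^ h *ₚ (oneₚ +ₚ X^ h))
    M≋X^h*B = ≋-trans (subst (λ m → M ≋ (X^ m +ₚ X^ h)) n≡h+h ≋-refl) (X^[h+h]+X^h≋X^h*[1+X^h] h)

odd⇒coprime-2 : ∀ {m} → Odd m → ℕC.Coprime m 2
odd⇒coprime-2 odd {zero}                (_ , 0∣2)   = contradiction (ℕ∣.0∣⇒≡0 0∣2) λ ()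
odd⇒coprime-2 odd {suc zero}            _           = refl
odd⇒coprime-2 odd {suc (suc zero)}      (2∣m , _)   = contradiction 2∣m odd
odd⇒coprime-2 odd {suc (suc (suc d))}   (_ , d∣2)   = contradiction (ℕ∣.∣⇒≤ d∣2) λ { (s≤s (s≤s ())) }

q*2≡q+q : ∀ q → q * 2 ≡ q + q
q*2≡q+q = solve-∀

theorem9 : (n : ℕ) → 1 ≤ n → 2 ∣ n → (m : ℕ) → IsLargestOddDivisor m n → (a : ℕ → Bool) →
    (Bijective _≡_ _≡_ (fMap n a) ⇔ IsUnitMod (X^ n +ₚ X^ (n / 2)) (aPoly n a))
    × (Bijective _≡_ _≡_ (fMap n a) ⇔
        (GcdOne (aPoly n a) (oneₚ +ₚ X^ (n / 2)) × GcdOne (aPoly n a) (oneₚ +ₚ X^ m)))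
theorem9 zero    ()
theorem9 (suc N) _ (ℕ∣.divides zero    ())
theorem9 (suc N) _ (ℕ∣.divides (suc h′) n≡h*2) m (m∣n , odd-m , _) a
  rewrite trans (cong (_/ 2) n≡h*2) (m*n/n≡m (suc h′) 2) =
  ⇔-trans bijective⇔coprime coprime⇔isUnitMod ,
  mk⇔ (λ bijective → let coprime = Equivalence.to bijective⇔coprime bijective in
         coprime⇒gcdOne coprime , coprime⇒gcdOne (coprime-∣ʳ coprime (1+X^-∣ m∣h)))
      (λ (gcdOne , _) → Equivalence.from bijective⇔coprime (gcdOne⇒coprime gcdOne))
  where
  n≡h+h : suc N ≡ suc h′ + suc h′
  n≡h+h = trans n≡h*2 (q*2≡q+q (suc h′))
  open Criterion a N h′ n≡h+h
  m∣h : m ∣ suc h′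
  m∣h = ℕC.coprime-divisor (odd⇒coprime-2 odd-m) (subst (m ∣_) (trans n≡h*2 (ℕ.*-comm (suc h′) 2)) m∣n)
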